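{- Let $p$ be a prime, let $G$ be a cyclic group of order $p^n$ with $n\ge 1$, and let $H$ be the unique subgroup of $G$ of order $p$. Let $R$ be a commutative ring with unit equipped with a ring homomorphism $\mathbb{Z}[\zeta_{p^n}]\to R$, and let $M$ be a finite $R[G]$-module. Assume that $\widehat{H}^0_{\chi}(H,M)=0$ for all $\chi\in\widehat{H}$. Then $\widehat{H}^0_{\psi}(G,M)=0$ for all $\psi\in\widehat{G}$, and $$[M]=\prod_{\psi\in\widehat{G}}[M^{\psi}]=\prod_{\psi\in\widehat{G}}[\varepsilon_\psi M].$$
   Context: $[X]$ is the order of a finite set $X$; $\zeta_{p^n}$ is a primitive complex $p^n$-th root of unity. For a subgroup $\Gamma\le G$, $\widehat\Gamma$ is the set of homomorphisms $\Gamma\to\mu_{p^n}\subset\mathbb{Z}[\zeta_{p^n}]^\times$, regarded as $R$-valued via the fixed homomorphism; products over $\widehat\Gamma$ are indexed by these $|\Gamma|$ characters. For $\chi\in\widehat\Gamma$ and an $R[\Gamma]$-module $N$: $N^\chi=\{m\in N:\sigma m=\chi(\sigma)m\ \forall\sigma\in\Gamma\}$, $\varepsilon_\chi=\sum_{\sigma\in\Gamma}\chi(\sigma)^{ -1}\sigma\in R[\Gamma]$, $\widehat H^0_\chi(\Gamma,N)=N^\chi/\varepsilon_\chi N$. -}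

module Defs where

open import Level using (Level; _⊔_)
open import Data.Nat using (ℕ; zero; suc; _∸_; _^_) renaming (_+_ to _+ℕ_; _*_ to _*ℕ_)
open import Data.Fin using (Fin; toℕ) renaming (zero to fzero; suc to fsuc)
open import Data.Product using (Σ; ∃; _×_; _,_)
open import Data.Unit.Polymorphic using (⊤)
open import Relation.Binary.PropositionalEquality using (_≡_)
open import Algebra.Bundles using (CommutativeRing)
open import Algebra.Module.Bundles using (Module)

prodFin : (N : ℕ) → (Fin N → ℕ) → ℕ
prodFin zero    f = 1
prodFin (suc N) f = f fzero *ℕ prodFin N (λ i → f (fsuc i))

module _ {r ℓr : Level} (R : CommutativeRing r ℓr) where
  open CommutativeRing R

  powR : Carrier → ℕ → Carrier
  powR x zero    = 1#
  powR x (suc k) = x * powR x k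

  sumR : (N : ℕ) → (ℕ → Carrier) → Carrier
  sumR zero    f = 0#
  sumR (suc N) f = sumR N f + f N

  -- The p^n-th cyclotomic polynomial evaluated at z (n ≥ 1):
  -- Φ_{p^n}(z) = Σ_{i<p} z^{i·p^(n-1)}.
  cyclotomicAt : (p n : ℕ) → Carrier → Carrier
  cyclotomicAt p n z = sumR p (λ i → powR z (i *ℕ p ^ (n ∸ 1)))

  -- A ring homomorphism ℤ[ζ_{p^n}] → R, i.e. ℤ[x]/(Φ_{p^n}) → R, is
  -- determined by the image z of ζ_{p^n}, which must be a root of Φ_{p^n}.
  record CyclotomicHom (p n : ℕ) : Set (r ⊔ ℓr) where
    field
      ζ      : Carrier
      isRoot : cyclotomicAt p n ζ ≈ 0#

module _ {r ℓr m ℓm : Level} {R : CommutativeRing r ℓr} (M : Module R m ℓm) where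
  open CommutativeRing R
  open Module M

  sumM : (N : ℕ) → (ℕ → Carrierᴹ) → Carrierᴹ
  sumM zero    f = 0ᴹ
  sumM (suc N) f = sumM N f +ᴹ f N

  iter : (Carrierᴹ → Carrierᴹ) → ℕ → Carrierᴹ → Carrierᴹ
  iter s zero    x = x
  iter s (suc k) x = s (iter s k x)

  -- An R[G]-module structure on the R-module M, for G cyclic of order N
  -- with a chosen generator σ: an R-linear action of σ with σ^N = id.
  record CyclicAction (N : ℕ) : Set (r ⊔ m ⊔ ℓm) where
    field
      σ       : Carrierᴹ → Carrierᴹ
      σ-cong  : ∀ {x y} → x ≈ᴹ y → σ x ≈ᴹ σ y
      σ-+     : ∀ x y → σ (x +ᴹ y) ≈ᴹ σ x +ᴹ σ y
      σ-*ₗ    : ∀ (a : Carrier) x → σ (a *ₗ x) ≈ᴹ a *ₗ σ x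
      σ-order : ∀ x → iter σ N x ≈ᴹ x

  record HasCard {ℓp : Level} (P : Carrierᴹ → Set ℓp) (k : ℕ) : Set (m ⊔ ℓm ⊔ ℓp) where
    field
      elt     : Fin k → Carrierᴹ
      elt-in  : ∀ i → P (elt i)
      elt-inj : ∀ i j → elt i ≈ᴹ elt j → i ≡ j
      elt-sur : ∀ x → P x → Σ (Fin k) (λ i → elt i ≈ᴹ x)

  Finite : Set (m ⊔ ℓm)
  Finite = Σ ℕ (λ k → HasCard {ℓp = Level.zero} (λ _ → ⊤) k)

  module _ {N : ℕ} (G : CyclicAction N) (z : Carrier) where
    open CyclicAction G

    -- Consider the subgroup Γ = ⟨σ^a⟩ of order q, and the character χ of Γ
    -- with χ((σ^a)^k) = ζ^(c·k) (ζ ↦ z in R).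
    --   M^χ = { x | ∀ γ ∈ Γ, γ x = χ(γ) x }
    eigen : (a q c : ℕ) → Carrierᴹ → Set ℓm
    eigen a q c x = ∀ (k : Fin q) →
      iter σ (a *ℕ toℕ k) x ≈ᴹ powR R z (c *ℕ toℕ k) *ₗ x

    --   ε_χ x = Σ_{γ∈Γ} χ(γ)^{-1} γ x, where χ(γ)^{-1} = χ(γ)^(N-1)
    --   since χ takes values in μ_N.
    epsilon : (a q c : ℕ) → Carrierᴹ → Carrierᴹ
    epsilon a q c x =
      sumM q (λ k → powR R z (c *ℕ k *ℕ (N ∸ 1)) *ₗ iter σ (a *ℕ k) x)

    epsImage : (a q c : ℕ) → Carrierᴹ → Set (m ⊔ ℓm)
    epsImage a q c x = Σ Carrierᴹ (λ y → epsilon a q c y ≈ᴹ x)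

    --   Ĥ^0_χ(Γ, M) = M^χ / ε_χ M = 0
    H0vanishes : (a q c : ℕ) → Set (m ⊔ ℓm)
    H0vanishes a q c = ∀ x → eigen a q c x → epsImage a q c x

{-# OPTIONS --safe #-}
module Submission where

-- Write P j = σ − ζ^j and E j = Σ_t ζ^(−jt) σ^t, polynomials in σ acting on M, so that
-- M^ψ = ker P j, ε_ψ M = im E j and P j E j = 0 for ψ(σ) = ζ^j.  Because Φ_{p^n}(ζ) = 0, every
-- commutative ring satisfies ∏_{0<i<p^n} (Y − ζ^i X) = Σ_{k<p^n} Y^k X^(p^n−1−k): for n = 1 the
-- elementary symmetric functions of ω, …, ω^(p−1) are ±1 by Newton's identities, and grouping
-- exponents by residue mod p gives the induction.  In the ring of polynomials in σ this yields
-- ∏_i P i = σ^(p^n) − 1 = 0 and E j ∈ (∏_{i<j} P i).  For H = ⟨σ^(p^(n−1))⟩ the analogous P′, E′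
-- satisfy P′ = P j U and E′ U = E j W; since M is finite, ker P′ ⊆ im E′ forces ker E′ ⊆ im P′
-- (Herbrand quotient), and then every w ∈ ker P j is E j z + p w′ with w′ ∈ ker P j.  Iterating n
-- times and using E j w′ = p^n w′ gives ker P j = im E j.  Finally, ker P j ⊆ im ∏_{i<j} P i makes
-- the images of the partial products drop by exactly |ker P j| at each step, so |M| = ∏_j |ker P j|.

open import Defs
open import Level using (_⊔_)
open import Data.Nat using (ℕ; zero; suc; _≤_; _<_; s≤s; z≤n; _∸_; NonZero; >-nonZero)
  renaming (_+_ to _+ℕ_; _*_ to _*ℕ_; _^_ to _^ℕ_)
import Data.Nat.Properties as ℕ
import Algebra.Properties.CommutativeSemigroup ℕ.*-commutativeSemigroup as ℕ*
open import Data.Nat.DivMod using (_%_; _/_; m≡m%n+[m/n]*n; m%n<n)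
open import Data.Nat.Divisibility using (_∣_; divides; ∣m+n∣m⇒∣n; ∣⇒≤)
open import Data.Nat.Primality using (Prime; euclidsLemma; prime⇒nonZero; prime⇒nonTrivial)
open import Data.Nat.Coprimality using (Coprime; coprime-Bézout; prime⇒coprime)
open import Data.Nat.GCD using (module Bézout)
open import Data.Nat.Solver using (module +-*-Solver)
open import Data.Fin using (Fin; toℕ; fromℕ<; punchOut; combine; remQuot) renaming (zero to fzero; suc to fsuc)
import Data.Fin.Properties as Fin
open import Data.Fin.Permutation using (Permutation; permutation)
open import Data.Product using (Σ; _,_; proj₁; proj₂; uncurry)
open import Data.Sum using (inj₁; inj₂)
open import Data.Empty using (⊥-elim)
open import Data.Unit.Polymorphic using (⊤; tt)
open import Relation.Binary.PropositionalEquality as ≡ using (_≡_; _≢_)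
open import Relation.Nullary using (Dec; yes; no)
open import Algebra.Bundles using (CommutativeRing; AbelianGroup)
open import Algebra.Structures using (IsCommutativeRing)
open import Algebra.Module.Bundles using (Module)

Fin-injective⇒surjective : ∀ {n} (f : Fin n → Fin n) → (∀ x y → f x ≡ f y → x ≡ y) →
  ∀ y → Σ (Fin n) (λ x → f x ≡ y)
Fin-injective⇒surjective {zero} f inj ()
Fin-injective⇒surjective {suc n} f inj y with Fin.any? (λ x → f x Fin.≟ y)
... | yes hit = hit
... | no miss = ⊥-elim (ℕ.<-irrefl ≡.refl (Fin.injective⇒≤ {f = g} g-injective))
  where
  y≢f : ∀ x → y ≢ f x
  y≢f x e = miss (x , ≡.sym e)
  g : Fin (suc n) → Fin n
  g x = punchOut (y≢f x)
  g-injective : ∀ {x x'} → g x ≡ g x' → x ≡ x'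
  g-injective {x} {x'} e = inj x x' (Fin.punchOut-injective (y≢f x) (y≢f x') e)

Fin-injective⇒permutation : ∀ {n} (f : Fin n → Fin n) → (∀ x y → f x ≡ f y → x ≡ y) →
  Permutation n n
Fin-injective⇒permutation f inj = permutation f (λ y → proj₁ (surj y)) (λ y → proj₂ (surj y))
  (λ x → inj _ _ (proj₂ (surj (f x))))
  where surj = Fin-injective⇒surjective f inj

record Enumeration {ℓ} (n : ℕ) (Q : Fin n → Set ℓ) : Set ℓ where
  field
    size       : ℕ
    index      : Fin size → Fin n
    index-in   : ∀ i → Q (index i)
    index-inj  : ∀ i j → index i ≡ index j → i ≡ j
    index-sur  : ∀ i → Q i → Σ (Fin size) (λ j → index j ≡ i)

enumerate : ∀ {ℓ} n (Q : Fin n → Set ℓ) → (∀ i → Dec (Q i)) → Enumeration n Q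
enumerate zero    Q Q? = record { size = 0 ; index = λ () ; index-in = λ () ; index-inj = λ () ; index-sur = λ () }
enumerate (suc n) Q Q? with enumerate n (λ i → Q (fsuc i)) (λ i → Q? (fsuc i)) | Q? fzero
... | E | yes Q0 = record
  { size = suc size ; index = index′ ; index-in = index′-in ; index-inj = index′-inj ; index-sur = index′-sur }
  where
  open Enumeration E
  index′ : Fin (suc size) → Fin (suc n)
  index′ fzero    = fzero
  index′ (fsuc i) = fsuc (index i)
  index′-in : ∀ i → Q (index′ i)
  index′-in fzero    = Q0
  index′-in (fsuc i) = index-in i
  index′-inj : ∀ i j → index′ i ≡ index′ j → i ≡ j
  index′-inj fzero    fzero    _ = ≡.refl
  index′-inj (fsuc i) (fsuc j) e = ≡.cong fsuc (index-inj i j (Fin.suc-injective e))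
  index′-sur : ∀ i → Q i → Σ (Fin (suc size)) (λ j → index′ j ≡ i)
  index′-sur fzero    _ = fzero , ≡.refl
  index′-sur (fsuc i) q with j , e ← index-sur i q = fsuc j , ≡.cong fsuc e
... | E | no ¬Q0 = record
  { size = size ; index = λ i → fsuc (index i) ; index-in = index-in
  ; index-inj = λ i j e → index-inj i j (Fin.suc-injective e) ; index-sur = index′-sur }
  where
  open Enumeration E
  index′-sur : ∀ i → Q i → Σ (Fin size) (λ j → fsuc (index j) ≡ i)
  index′-sur fzero    q = ⊥-elim (¬Q0 q)
  index′-sur (fsuc i) q with j , e ← index-sur i q = j , ≡.cong fsuc e

prodFin-cong : ∀ r {f g : Fin r → ℕ} → (∀ i → f i ≡ g i) → prodFin r f ≡ prodFin r g
prodFin-cong zero    f≡g = ≡.refl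
prodFin-cong (suc r) f≡g = ≡.cong₂ _*ℕ_ (f≡g fzero) (prodFin-cong r (λ i → f≡g (fsuc i)))

%-≡⇒∣ : ∀ x y p .{{_ : NonZero p}} → x % p ≡ (x +ℕ y) % p → p ∣ y
%-≡⇒∣ x y p x%p≡[x+y]%p = ∣m+n∣m⇒∣n (divides ((x +ℕ y) / p) quotients) (divides (x / p) ≡.refl)
  where
  open ≡.≡-Reasoning
  quotients : (x / p) *ℕ p +ℕ y ≡ ((x +ℕ y) / p) *ℕ p
  quotients = ℕ.+-cancelˡ-≡ (x % p) _ _ (begin
    x % p +ℕ ((x / p) *ℕ p +ℕ y)      ≡⟨ ℕ.+-assoc (x % p) _ y ⟨
    (x % p +ℕ (x / p) *ℕ p) +ℕ y      ≡⟨ ≡.cong (_+ℕ y) (m≡m%n+[m/n]*n x p) ⟨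
    x +ℕ y                            ≡⟨ m≡m%n+[m/n]*n (x +ℕ y) p ⟩
    (x +ℕ y) % p +ℕ ((x +ℕ y) / p) *ℕ p ≡⟨ ≡.cong (_+ℕ ((x +ℕ y) / p) *ℕ p) x%p≡[x+y]%p ⟨
    x % p +ℕ ((x +ℕ y) / p) *ℕ p      ∎)

private
  *-cancel-mod-prime-≤ : ∀ p .{{_ : NonZero p}} → Prime p → ∀ {i b b'} → 0 < i → i < p → b ≤ b' → b' < p →
    (b *ℕ i) % p ≡ (b' *ℕ i) % p → b ≡ b'
  *-cancel-mod-prime-≤ p p-prime {i} {b} {b'} 0<i i<p b≤b' b'<p eq with euclidsLemma (b' ∸ b) i p-prime p∣[b'-b]i
    where
    p∣[b'-b]i : p ∣ (b' ∸ b) *ℕ i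
    p∣[b'-b]i = %-≡⇒∣ (b *ℕ i) ((b' ∸ b) *ℕ i) p (≡.trans eq (≡.cong (_% p)
      (≡.trans (≡.cong (_*ℕ i) (≡.sym (ℕ.m+[n∸m]≡n b≤b'))) (ℕ.*-distribʳ-+ i b (b' ∸ b)))))
  ... | inj₂ p∣i = ⊥-elim (ℕ.<⇒≱ i<p (∣⇒≤ {{>-nonZero 0<i}} p∣i))
  ... | inj₁ p∣b'-b with b' ∸ b in b'-b≡d
  ...   | zero  = ≡.sym (≡.trans (≡.sym (ℕ.m+[n∸m]≡n b≤b')) (≡.trans (≡.cong (b +ℕ_) b'-b≡d) (ℕ.+-identityʳ b)))
  ...   | suc d = ⊥-elim (ℕ.<⇒≱ (ℕ.≤-<-trans (≡.subst (_≤ b') b'-b≡d (ℕ.m∸n≤m b' b)) b'<p) (∣⇒≤ p∣b'-b))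

*-cancel-mod-prime : ∀ p .{{_ : NonZero p}} → Prime p → ∀ {i b b'} → 0 < i → i < p → b < p → b' < p →
  (b *ℕ i) % p ≡ (b' *ℕ i) % p → b ≡ b'
*-cancel-mod-prime p p-prime {b = b} {b'} 0<i i<p b<p b'<p eq with ℕ.≤-total b b'
... | inj₁ b≤b' = *-cancel-mod-prime-≤ p p-prime 0<i i<p b≤b' b'<p eq
... | inj₂ b'≤b = ≡.sym (*-cancel-mod-prime-≤ p p-prime 0<i i<p b'≤b b<p (≡.sym eq))

p-adic-count : ∀ p' L' → suc (p' +ℕ suc p' *ℕ L') ≡ suc p' *ℕ suc L'
p-adic-count = solve 2 (λ p' L' → con 1 :+ (p' :+ (con 1 :+ p') :* L') := (con 1 :+ p') :* (con 1 :+ L')) ≡.refl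
  where open +-*-Solver

j+suc[r+i]≡i+suc[r+j] : ∀ j r i → j +ℕ suc (r +ℕ i) ≡ i +ℕ suc (r +ℕ j)
j+suc[r+i]≡i+suc[r+j] = solve 3 (λ j r i → j :+ (con 1 :+ (r :+ i)) := i :+ (con 1 :+ (r :+ j))) ≡.refl
  where open +-*-Solver

j*[N∸1]+j≡N*j : ∀ j N → 1 ≤ N → j *ℕ (N ∸ 1) +ℕ j ≡ N *ℕ j
j*[N∸1]+j≡N*j j N 1≤N = ≡.trans (solve 2 (λ j e → j :* e :+ j := (con 1 :+ e) :* j) ≡.refl j (N ∸ 1))
                                (≡.cong (_*ℕ j) (ℕ.m+[n∸m]≡n 1≤N))
  where open +-*-Solver

-- Cyclotomic product identities in commutative rings

module FiniteSumsAndProducts {a ℓ} (S : CommutativeRing a ℓ) where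
  open CommutativeRing S
  open import Relation.Binary.Reasoning.Setoid setoid
  open import Algebra.Solver.Ring.NaturalCoefficients.Default commutativeSemiring
  open import Algebra.Properties.CommutativeSemiring.Exp commutativeSemiring
  open import Algebra.Properties.Semiring.Mult semiring using (_×_)
  import Algebra.Properties.CommutativeMonoid.Sum +-commutativeMonoid as FinSum

  ∑ : ℕ → (ℕ → Carrier) → Carrier
  ∑ = sumR S

  ∏ : ℕ → (ℕ → Carrier) → Carrier
  ∏ zero    f = 1#
  ∏ (suc n) f = ∏ n f * f n

  infix 5 ∑ ∏
  syntax ∑ n (λ i → x) = ∑[ i < n ] x
  syntax ∏ n (λ i → x) = ∏[ i < n ] x

  1^n≈1 : ∀ n → 1# ^ n ≈ 1#
  1^n≈1 zero    = refl
  1^n≈1 (suc n) = trans (*-identityˡ _) (1^n≈1 n)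

  ∑-cong : ∀ n {f g} → (∀ i → f i ≈ g i) → ∑ n f ≈ ∑ n g
  ∑-cong zero    f≈g = refl
  ∑-cong (suc n) f≈g = +-cong (∑-cong n f≈g) (f≈g n)

  ∑-split : ∀ m n f → ∑ (m +ℕ n) f ≈ ∑ m f + (∑[ i < n ] f (m +ℕ i))
  ∑-split m zero f = ≡.subst (λ t → ∑ t f ≈ ∑ m f + 0#) (≡.sym (ℕ.+-identityʳ m)) (sym (+-identityʳ _))
  ∑-split m (suc n) f = begin
    ∑ (m +ℕ suc n) f                           ≡⟨ ≡.cong (λ t → ∑ t f) (ℕ.+-suc m n) ⟩
    ∑ (m +ℕ n) f + f (m +ℕ n)                  ≈⟨ +-congʳ (∑-split m n f) ⟩
    (∑ m f + (∑[ i < n ] f (m +ℕ i))) + f (m +ℕ n) ≈⟨ +-assoc _ _ _ ⟩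
    ∑ m f + (∑[ i < suc n ] f (m +ℕ i))           ∎

  ∑-unfoldˡ : ∀ n f → ∑ (suc n) f ≈ f 0 + (∑[ i < n ] f (suc i))
  ∑-unfoldˡ n f = trans (∑-split 1 n f) (+-congʳ (+-identityˡ (f 0)))

  ∑-const : ∀ n x → ∑[ _ < n ] x ≈ n × x
  ∑-const zero    x = refl
  ∑-const (suc n) x = trans (+-congʳ (∑-const n x)) (+-comm _ x)

  ∑-distribʳ : ∀ n f x → ∑ n f * x ≈ ∑[ i < n ] (f i * x)
  ∑-distribʳ zero    f x = zeroˡ x
  ∑-distribʳ (suc n) f x = trans (distribʳ x _ _) (+-congʳ (∑-distribʳ n f x))

  ∑≈FinSum : ∀ n f → ∑ n f ≈ FinSum.sum (λ (i : Fin n) → f (toℕ i))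
  ∑≈FinSum zero    f = refl
  ∑≈FinSum (suc n) f = trans (∑-unfoldˡ n f) (+-congˡ (∑≈FinSum n (λ i → f (suc i))))

  ∑-reindex : ∀ n f (π : ℕ → ℕ) → (∀ i → i < n → π i < n) →
    (∀ i j → i < n → j < n → π i ≡ π j → i ≡ j) → ∑[ i < n ] f (π i) ≈ ∑ n f
  ∑-reindex n f π π<n π-injective = begin
    ∑[ i < n ] f (π i)                        ≈⟨ ∑≈FinSum n _ ⟩
    FinSum.sum {n} (λ i → f (π (toℕ i)))      ≡⟨ FinSum.sum-cong-≗ π-toℕ ⟨
    FinSum.sum {n} (λ i → f (toℕ (πᶠ i)))     ≈⟨ FinSum.sum-permute (λ i → f (toℕ i)) perm ⟨
    FinSum.sum {n} (λ i → f (toℕ i))          ≈⟨ ∑≈FinSum n f ⟨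
    ∑ n f                                     ∎
    where
    πᶠ : Fin n → Fin n
    πᶠ i = fromℕ< (π<n (toℕ i) (Fin.toℕ<n i))
    π-toℕ : ∀ i → f (toℕ (πᶠ i)) ≡ f (π (toℕ i))
    π-toℕ i = ≡.cong f (Fin.toℕ-fromℕ< _)
    πᶠ-injective : ∀ i j → πᶠ i ≡ πᶠ j → i ≡ j
    πᶠ-injective i j e = Fin.toℕ-injective (π-injective _ _ (Fin.toℕ<n i) (Fin.toℕ<n j)
      (≡.trans (≡.sym (Fin.toℕ-fromℕ< _)) (≡.trans (≡.cong toℕ e) (Fin.toℕ-fromℕ< _))))
    perm = Fin-injective⇒permutation πᶠ πᶠ-injective

  ∏-cong : ∀ n {f g} → (∀ i → f i ≈ g i) → ∏ n f ≈ ∏ n g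
  ∏-cong zero    f≈g = refl
  ∏-cong (suc n) f≈g = *-cong (∏-cong n f≈g) (f≈g n)

  ∏-split : ∀ m n f → ∏ (m +ℕ n) f ≈ ∏ m f * (∏[ i < n ] f (m +ℕ i))
  ∏-split m zero f = ≡.subst (λ t → ∏ t f ≈ ∏ m f * 1#) (≡.sym (ℕ.+-identityʳ m)) (sym (*-identityʳ _))
  ∏-split m (suc n) f = begin
    ∏ (m +ℕ suc n) f                             ≡⟨ ≡.cong (λ t → ∏ t f) (ℕ.+-suc m n) ⟩
    ∏ (m +ℕ n) f * f (m +ℕ n)                    ≈⟨ *-congʳ (∏-split m n f) ⟩
    (∏ m f * (∏[ i < n ] f (m +ℕ i))) * f (m +ℕ n) ≈⟨ *-assoc _ _ _ ⟩
    ∏ m f * (∏[ i < suc n ] f (m +ℕ i))            ∎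

  ∏-unfoldˡ : ∀ n f → ∏ (suc n) f ≈ f 0 * (∏[ i < n ] f (suc i))
  ∏-unfoldˡ n f = trans (∏-split 1 n f) (*-congʳ (*-identityˡ (f 0)))

  ∏-blocks : ∀ L q g → ∏ (L *ℕ q) g ≈ ∏[ b < q ] ∏[ a < L ] g (L *ℕ b +ℕ a)
  ∏-blocks L zero g = ≡.subst (λ t → ∏ t g ≈ 1#) (≡.sym (ℕ.*-zeroʳ L)) refl
  ∏-blocks L (suc q) g = begin
    ∏ (L *ℕ suc q) g ≡⟨ ≡.cong (λ t → ∏ t g) (≡.trans (ℕ.*-suc L q) (ℕ.+-comm L (L *ℕ q))) ⟩
    ∏ (L *ℕ q +ℕ L) g                                ≈⟨ ∏-split (L *ℕ q) L g ⟩
    ∏ (L *ℕ q) g * (∏[ a < L ] g (L *ℕ q +ℕ a))        ≈⟨ *-congʳ (∏-blocks L q g) ⟩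
    ∏[ b < suc q ] ∏[ a < L ] g (L *ℕ b +ℕ a)        ∎

  ∏-distrib : ∀ n f g → ∏[ i < n ] (f i * g i) ≈ ∏ n f * ∏ n g
  ∏-distrib zero    f g = sym (*-identityˡ 1#)
  ∏-distrib (suc n) f g = trans (*-congʳ (∏-distrib n f g))
    (solve 4 (λ a b c d → (a :* b) :* (c :* d) := (a :* c) :* (b :* d)) refl (∏ n f) (∏ n g) (f n) (g n))

  ∏-const : ∀ n x → ∏[ _ < n ] x ≈ x ^ n
  ∏-const zero    x = refl
  ∏-const (suc n) x = trans (*-congʳ (∏-const n x)) (*-comm _ x)

  ∏-comm : ∀ A B (f : ℕ → ℕ → Carrier) → ∏[ a < A ] ∏[ b < B ] f a b ≈ ∏[ b < B ] ∏[ a < A ] f a b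
  ∏-comm zero B f = sym (trans (∏-cong B (λ _ → refl)) (trans (∏-const B 1#) (1^n≈1 B)))
  ∏-comm (suc A) B f = begin
    (∏[ a < A ] ∏[ b < B ] f a b) * (∏[ b < B ] f A b) ≈⟨ *-congʳ (∏-comm A B f) ⟩
    (∏[ b < B ] ∏[ a < A ] f a b) * (∏[ b < B ] f A b) ≈⟨ ∏-distrib B _ _ ⟨
    ∏[ b < B ] ∏[ a < suc A ] f a b                ∎

module GeometricSums {a ℓ} (S : CommutativeRing a ℓ) where
  open CommutativeRing S
  open import Relation.Binary.Reasoning.Setoid setoid
  open import Algebra.Solver.Ring.NaturalCoefficients.Default commutativeSemiring
  open import Algebra.Properties.CommutativeSemiring.Exp commutativeSemiring
  open import Algebra.Properties.Ring ring using (-‿distribˡ-*)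
  import Algebra.Properties.AbelianGroup +-abelianGroup as AG
  import Algebra.Properties.Group +-group as G⁺
  open FiniteSumsAndProducts S

  -- geom m Y X = Σ_{k<m} Y^k X^(m−1−k)
  geom : ℕ → Carrier → Carrier → Carrier
  geom zero    Y X = 0#
  geom (suc m) Y X = Y * geom m Y X + X ^ m

  geom-cong : ∀ m {Y Y' X X'} → Y ≈ Y' → X ≈ X' → geom m Y X ≈ geom m Y' X'
  geom-cong zero    Y≈Y' X≈X' = refl
  geom-cong (suc m) Y≈Y' X≈X' = +-cong (*-cong Y≈Y' (geom-cong m Y≈Y' X≈X')) (^-congˡ m X≈X')

  geom-sucʳ : ∀ m Y X → geom (suc m) Y X ≈ X * geom m Y X + Y ^ m
  geom-sucʳ zero    Y X = trans (+-congʳ (zeroʳ Y)) (sym (+-congʳ (zeroʳ X)))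
  geom-sucʳ (suc m) Y X = begin
    Y * geom (suc m) Y X + X ^ suc m       ≈⟨ +-congʳ (*-congˡ (geom-sucʳ m Y X)) ⟩
    Y * (X * G + Y ^ m) + X * X ^ m
      ≈⟨ solve 5 (λ x y g a b → y :* (x :* g :+ b) :+ x :* a := x :* (y :* g :+ a) :+ y :* b) refl X Y G (X ^ m) (Y ^ m) ⟩
    X * geom (suc m) Y X + Y ^ suc m       ∎
    where G = geom m Y X

  geom-+ : ∀ a b Y X → geom (a +ℕ b) Y X ≈ X ^ b * geom a Y X + Y ^ a * geom b Y X
  geom-+ a zero Y X = ≡.subst (λ t → geom t Y X ≈ 1# * geom a Y X + Y ^ a * 0#) (≡.sym (ℕ.+-identityʳ a))
    (sym (trans (+-cong (*-identityˡ _) (zeroʳ _)) (+-identityʳ _)))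
  geom-+ a (suc b) Y X = begin
    geom (a +ℕ suc b) Y X                        ≡⟨ ≡.cong (λ t → geom t Y X) (ℕ.+-suc a b) ⟩
    Y * geom (a +ℕ b) Y X + X ^ (a +ℕ b)         ≈⟨ +-cong (*-congˡ (geom-+ a b Y X)) (^-homo-* X a b) ⟩
    Y * (X ^ b * Ga + Y ^ a * Gb) + X ^ a * X ^ b
      ≈⟨ solve 6 (λ y xb ga ya gb xa → y :* (xb :* ga :+ ya :* gb) :+ xa :* xb
                                        := xb :* (y :* ga :+ xa) :+ ya :* (y :* gb)) refl Y (X ^ b) Ga (Y ^ a) Gb (X ^ a) ⟩
    X ^ b * geom (suc a) Y X + Y ^ a * (Y * Gb)  ≈⟨ +-congʳ (*-congˡ (geom-sucʳ a Y X)) ⟩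
    X ^ b * (X * Ga + Y ^ a) + Y ^ a * (Y * Gb)
      ≈⟨ solve 6 (λ xb x ga ya y gb → xb :* (x :* ga :+ ya) :+ ya :* (y :* gb)
                                        := (x :* xb) :* ga :+ ya :* (y :* gb :+ xb)) refl (X ^ b) X Ga (Y ^ a) Y Gb ⟩
    X ^ suc b * Ga + Y ^ a * geom (suc b) Y X    ∎
    where Ga = geom a Y X ; Gb = geom b Y X

  geom-* : ∀ L q Y X → geom (L *ℕ q) Y X ≈ geom L Y X * geom q (Y ^ L) (X ^ L)
  geom-* L zero Y X = ≡.subst (λ t → geom t Y X ≈ geom L Y X * 0#) (≡.sym (ℕ.*-zeroʳ L)) (sym (zeroʳ _))
  geom-* L (suc q) Y X = begin
    geom (L *ℕ suc q) Y X ≡⟨ ≡.cong (λ t → geom t Y X) (≡.trans (ℕ.*-suc L q) (ℕ.+-comm L (L *ℕ q))) ⟩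
    geom (L *ℕ q +ℕ L) Y X                           ≈⟨ geom-+ (L *ℕ q) L Y X ⟩
    X ^ L * geom (L *ℕ q) Y X + Y ^ (L *ℕ q) * GL    ≈⟨ +-cong (*-congˡ (geom-* L q Y X)) (*-congʳ (sym (^-assocʳ Y L q))) ⟩
    X ^ L * (GL * Gq) + (Y ^ L) ^ q * GL
      ≈⟨ solve 4 (λ xl gl gq yq → xl :* (gl :* gq) :+ yq :* gl := gl :* (xl :* gq :+ yq)) refl (X ^ L) GL Gq ((Y ^ L) ^ q) ⟩
    GL * (X ^ L * Gq + (Y ^ L) ^ q)                  ≈⟨ *-congˡ (geom-sucʳ q (Y ^ L) (X ^ L)) ⟨
    GL * geom (suc q) (Y ^ L) (X ^ L)                ∎
    where GL = geom L Y X ; Gq = geom q (Y ^ L) (X ^ L)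

  a+d≈b+c⇒a-b≈c-d : ∀ {a b c d} → a + d ≈ b + c → a - b ≈ c - d
  a+d≈b+c⇒a-b≈c-d {a} {b} {c} {d} a+d≈b+c = G⁺.x∙y⁻¹≈ε⇒x≈y (a - b) (c - d) (begin
    (a - b) - (c - d)        ≈⟨ +-congˡ (trans (sym (AG.⁻¹-∙-comm c (- d))) (+-congˡ (G⁺.⁻¹-involutive d))) ⟩
    (a - b) + (- c + d)      ≈⟨ solve 4 (λ a nb nc d → (a :+ nb) :+ (nc :+ d) := (a :+ d) :+ (nb :+ nc)) refl a (- b) (- c) d ⟩
    (a + d) + (- b + - c)    ≈⟨ +-cong a+d≈b+c (AG.⁻¹-∙-comm b c) ⟩
    (b + c) - (b + c)        ≈⟨ -‿inverseʳ (b + c) ⟩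
    0#                       ∎)

  geom-telescope : ∀ m Y X → (Y - X) * geom m Y X ≈ Y ^ m - X ^ m
  geom-telescope m Y X = begin
    (Y - X) * G              ≈⟨ distribʳ G Y (- X) ⟩
    Y * G + (- X) * G        ≈⟨ +-congˡ (sym (-‿distribˡ-* X G)) ⟩
    Y * G - X * G            ≈⟨ a+d≈b+c⇒a-b≈c-d (geom-sucʳ m Y X) ⟩
    Y ^ m - X ^ m            ∎
    where G = geom m Y X

  geom-homogeneous : ∀ m a Y X → a * geom m (a * Y) (a * X) ≈ a ^ m * geom m Y X
  geom-homogeneous zero    a Y X = trans (zeroʳ a) (sym (zeroʳ 1#))
  geom-homogeneous (suc m) a Y X = begin
    a * ((a * Y) * geom m (a * Y) (a * X) + (a * X) ^ m)
      ≈⟨ solve 4 (λ a y g x → a :* ((a :* y) :* g :+ x) := (a :* y) :* (a :* g) :+ a :* x) refl a Y (geom m (a * Y) (a * X)) ((a * X) ^ m) ⟩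
    (a * Y) * (a * geom m (a * Y) (a * X)) + a * (a * X) ^ m
      ≈⟨ +-cong (*-congˡ (geom-homogeneous m a Y X)) (*-congˡ (^-distrib-* a X m)) ⟩
    (a * Y) * (a ^ m * G) + a * (a ^ m * X ^ m)
      ≈⟨ solve 5 (λ a y am g xm → (a :* y) :* (am :* g) :+ a :* (am :* xm) := (a :* am) :* (y :* g :+ xm)) refl a Y (a ^ m) G (X ^ m) ⟩
    a ^ suc m * geom (suc m) Y X                 ∎
    where G = geom m Y X

  geom-1ʳ : ∀ m Y → geom m Y 1# ≈ ∑[ i < m ] Y ^ i
  geom-1ʳ zero    Y = refl
  geom-1ʳ (suc m) Y = trans (geom-sucʳ m Y 1#) (+-congʳ (trans (*-identityˡ _) (geom-1ʳ m Y)))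

module Convolution {a ℓ} (S : CommutativeRing a ℓ) where
  open CommutativeRing S
  open import Algebra.Solver.Ring.NaturalCoefficients.Default commutativeSemiring

  -- convolve u v k = Σ_{i≤k} u i * v (k − i)
  convolve : (ℕ → Carrier) → (ℕ → Carrier) → ℕ → Carrier
  convolve u v zero    = u 0 * v 0
  convolve u v (suc k) = u 0 * v (suc k) + convolve (λ i → u (suc i)) v k

  convolve-cong : ∀ k {u u' v v'} → (∀ i → u i ≈ u' i) → (∀ j → v j ≈ v' j) →
    convolve u v k ≈ convolve u' v' k
  convolve-cong zero    u≈u' v≈v' = *-cong (u≈u' 0) (v≈v' 0)
  convolve-cong (suc k) u≈u' v≈v' =
    +-cong (*-cong (u≈u' 0) (v≈v' (suc k))) (convolve-cong k (λ i → u≈u' (suc i)) v≈v')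

  convolve-+ˡ : ∀ k u u' v → convolve (λ i → u i + u' i) v k ≈ convolve u v k + convolve u' v k
  convolve-+ˡ zero    u u' v = distribʳ (v 0) (u 0) (u' 0)
  convolve-+ˡ (suc k) u u' v = trans (+-cong (distribʳ _ _ _) (convolve-+ˡ k _ _ v))
    (solve 4 (λ a b c d → (a :+ b) :+ (c :+ d) := (a :+ c) :+ (b :+ d)) refl _ _ _ _)

  convolve-+ʳ : ∀ k u v v' → convolve u (λ j → v j + v' j) k ≈ convolve u v k + convolve u v' k
  convolve-+ʳ zero    u v v' = distribˡ (u 0) (v 0) (v' 0)
  convolve-+ʳ (suc k) u v v' = trans (+-cong (distribˡ _ _ _) (convolve-+ʳ k _ v v'))
    (solve 4 (λ a b c d → (a :+ b) :+ (c :+ d) := (a :+ c) :+ (b :+ d)) refl _ _ _ _)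

  convolve-*ʳ : ∀ k u v c → convolve u (λ j → c * v j) k ≈ c * convolve u v k
  convolve-*ʳ zero    u v c = solve 3 (λ a b c → a :* (c :* b) := c :* (a :* b)) refl (u 0) (v 0) c
  convolve-*ʳ (suc k) u v c = trans
    (+-cong (solve 3 (λ a b c → a :* (c :* b) := c :* (a :* b)) refl (u 0) (v (suc k)) c) (convolve-*ʳ k _ v c))
    (sym (distribˡ c _ _))

  convolve-zeroˡ : ∀ k u v → (∀ i → i ≤ k → u i ≈ 0#) → convolve u v k ≈ 0#
  convolve-zeroˡ zero    u v u≈0 = trans (*-congʳ (u≈0 0 z≤n)) (zeroˡ _)
  convolve-zeroˡ (suc k) u v u≈0 = trans
    (+-cong (trans (*-congʳ (u≈0 0 z≤n)) (zeroˡ _)) (convolve-zeroˡ k _ v (λ i i≤k → u≈0 (suc i) (s≤s i≤k))))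
    (+-identityˡ 0#)

  delay : (ℕ → Carrier) → ℕ → Carrier
  delay v zero    = 0#
  delay v (suc j) = v j

  convolve-delayʳ : ∀ k u v → convolve u (delay v) (suc k) ≈ convolve u v k
  convolve-delayʳ zero    u v = trans (+-congˡ (zeroʳ _)) (+-identityʳ _)
  convolve-delayʳ (suc k) u v = +-congˡ (convolve-delayʳ k _ v)

module HomogeneousForms {a ℓ} (S : CommutativeRing a ℓ) (Y X : CommutativeRing.Carrier S) where
  open CommutativeRing S
  open import Algebra.Solver.Ring.NaturalCoefficients.Default commutativeSemiring
  open import Algebra.Properties.CommutativeSemiring.Exp commutativeSemiring
  open GeometricSums S using (geom)
  open Convolution S using (delay)

  -- form c m = Σ_{k≤m} c k * Y^(m−k) * X^k
  form : (ℕ → Carrier) → ℕ → Carrier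
  form c zero    = c 0
  form c (suc m) = Y * form c m + c (suc m) * X ^ suc m

  form-cong≤ : ∀ m {c c'} → (∀ k → k ≤ m → c k ≈ c' k) → form c m ≈ form c' m
  form-cong≤ zero    c≈c' = c≈c' 0 z≤n
  form-cong≤ (suc m) c≈c' =
    +-cong (*-congˡ (form-cong≤ m (λ k k≤m → c≈c' k (ℕ.m≤n⇒m≤1+n k≤m)))) (*-congʳ (c≈c' (suc m) ℕ.≤-refl))

  form-+ : ∀ m c c' → form (λ k → c k + c' k) m ≈ form c m + form c' m
  form-+ zero    c c' = refl
  form-+ (suc m) c c' = trans (+-cong (*-congˡ (form-+ m c c')) (distribʳ _ _ _))
    (solve 5 (λ y a b c d → y :* (a :+ b) :+ (c :+ d) := (y :* a :+ c) :+ (y :* b :+ d)) refl Y _ _ _ _)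

  form-*ˡ : ∀ m d c → form (λ k → d * c k) m ≈ d * form c m
  form-*ˡ zero    d c = refl
  form-*ˡ (suc m) d c = trans (+-congʳ (*-congˡ (form-*ˡ m d c)))
    (solve 5 (λ y d h c x → y :* (d :* h) :+ d :* c :* x := d :* (y :* h :+ c :* x)) refl Y d _ _ _)

  form-delay : ∀ m c → form (delay c) (suc m) ≈ X * form c m
  form-delay zero    c = trans (+-cong (zeroʳ Y) (*-congˡ (*-identityʳ X)))
    (trans (+-identityˡ _) (*-comm _ _))
  form-delay (suc m) c = trans (+-congʳ (*-congˡ (form-delay m c)))
    (solve 5 (λ y x h c px → y :* (x :* h) :+ c :* (x :* px) := x :* (y :* h :+ c :* px)) refl Y X _ _ _)

  form-1 : ∀ m → form (λ _ → 1#) m ≈ geom (suc m) Y X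
  form-1 zero    = sym (trans (+-congʳ (zeroʳ Y)) (+-identityˡ 1#))
  form-1 (suc m) = +-cong (*-congˡ (form-1 m)) (*-identityˡ _)

module ElementarySymmetric {a ℓ} (S : CommutativeRing a ℓ) (α : ℕ → CommutativeRing.Carrier S) where
  open CommutativeRing S
  open import Relation.Binary.Reasoning.Setoid setoid
  open import Algebra.Solver.Ring.NaturalCoefficients.Default commutativeSemiring
  open import Algebra.Properties.CommutativeSemiring.Exp commutativeSemiring
  open import Algebra.Properties.Semiring.Mult semiring using (_×_)
  open import Algebra.Properties.Ring ring using (-‿distribˡ-*; -‿distribʳ-*; -1*x≈-x)
  open FiniteSumsAndProducts S
  open Convolution S

  -- e k m is the k-th elementary symmetric polynomial in α 0, …, α (m − 1).
  e : ℕ → ℕ → Carrier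
  e zero    m       = 1#
  e (suc k) zero    = 0#
  e (suc k) (suc m) = e (suc k) m + α m * e k m

  e-suc : ∀ m k → e k (suc m) ≈ e k m + α m * delay (λ j → e j m) k
  e-suc m zero    = sym (trans (+-congˡ (zeroʳ _)) (+-identityʳ _))
  e-suc m (suc k) = refl

  e-vanishes : ∀ {k m} → m ≤ k → e (suc k) m ≈ 0#
  e-vanishes {m = zero}  _ = refl
  e-vanishes {suc k} {suc m} (s≤s m≤k) =
    trans (+-cong (e-vanishes (ℕ.m≤n⇒m≤1+n m≤k)) (trans (*-congˡ (e-vanishes m≤k)) (zeroʳ _))) (+-identityʳ 0#)

  powerSum : ℕ → ℕ → Carrier
  powerSum i m = ∑[ b < m ] α b ^ i

  newtonTerm : ℕ → ℕ → Carrier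
  newtonTerm m i = (- 1#) ^ i * powerSum (suc i) m

  convolve-geometric : ∀ m k (g : ℕ → Carrier) → (∀ i → g (suc i) ≈ (- α m) * g i) →
    convolve g (λ j → e j (suc m)) k ≈ g 0 * e k m
  convolve-geometric m zero g g-ratio = *-congˡ (trans (e-suc m 0) (trans (+-congˡ (zeroʳ _)) (+-identityʳ _)))
  convolve-geometric m (suc k) g g-ratio = begin
    g 0 * e (suc k) (suc m) + convolve (λ i → g (suc i)) (λ j → e j (suc m)) k
      ≈⟨ +-congˡ (convolve-geometric m k (λ i → g (suc i)) (λ i → g-ratio (suc i))) ⟩
    g 0 * (e (suc k) m + α m * e k m) + g 1 * e k m  ≈⟨ +-congˡ (*-congʳ (g-ratio 0)) ⟩
    g 0 * (e (suc k) m + α m * e k m) + (- α m) * g 0 * e k m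
      ≈⟨ solve 5 (λ g0 x a na y → g0 :* (x :+ a :* y) :+ na :* g0 :* y := g0 :* x :+ (a :+ na) :* (g0 :* y))
                 refl (g 0) (e (suc k) m) (α m) (- α m) (e k m) ⟩
    g 0 * e (suc k) m + (α m - α m) * (g 0 * e k m)  ≈⟨ +-congˡ (trans (*-congʳ (-‿inverseʳ (α m))) (zeroˡ _)) ⟩
    g 0 * e (suc k) m + 0#                           ≈⟨ +-identityʳ _ ⟩
    g 0 * e (suc k) m                                ∎

  newton : ∀ m k → (suc k × 1#) * e (suc k) m ≈ convolve (newtonTerm m) (λ j → e j m) k
  newton zero k = trans (zeroʳ _) (sym (convolve-zeroˡ k (newtonTerm 0) _ (λ i _ → zeroʳ _)))
  newton (suc m) k = sym (begin
    convolve (newtonTerm (suc m)) E′ k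
      ≈⟨ convolve-cong k (λ i → distribˡ ((- 1#) ^ i) _ _) (λ _ → refl) ⟩
    convolve (λ i → newtonTerm m i + g i) E′ k
      ≈⟨ convolve-+ˡ k (newtonTerm m) g E′ ⟩
    convolve (newtonTerm m) E′ k + convolve g E′ k
      ≈⟨ +-cong (trans (convolve-cong k (λ _ → refl) (e-suc m)) (convolve-+ʳ k (newtonTerm m) E _))
                (convolve-geometric m k g g-ratio) ⟩
    (convolve (newtonTerm m) E k + convolve (newtonTerm m) (λ j → α m * delay E j) k) + g 0 * e k m
      ≈⟨ +-cong (+-cong (sym (newton m k)) (trans (convolve-*ʳ k (newtonTerm m) (delay E) (α m)) (*-congˡ (delayed k))))
                (*-congʳ g0≈αm) ⟩
    ((suc k × 1#) * e (suc k) m + α m * ((k × 1#) * e k m)) + α m * e k m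
      ≈⟨ solve 4 (λ n x a y → ((con 1 :+ n) :* x :+ a :* (n :* y)) :+ a :* y := (con 1 :+ n) :* (x :+ a :* y))
                 refl (k × 1#) (e (suc k) m) (α m) (e k m) ⟩
    (suc k × 1#) * e (suc k) (suc m) ∎)
    where
    E E′ g : ℕ → Carrier
    E j = e j m
    E′ j = e j (suc m)
    g i = (- 1#) ^ i * α m ^ suc i
    g-ratio : ∀ i → g (suc i) ≈ (- α m) * g i
    g-ratio i = begin
      (- 1#) * (- 1#) ^ i * (α m * α m ^ suc i)
        ≈⟨ solve 4 (λ n s a p → n :* s :* (a :* p) := (n :* a) :* (s :* p)) refl (- 1#) ((- 1#) ^ i) (α m) _ ⟩
      ((- 1#) * α m) * g i ≈⟨ *-congʳ (trans (sym (-‿distribˡ-* 1# (α m))) (-‿cong (*-identityˡ _))) ⟩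
      (- α m) * g i        ∎
    g0≈αm : g 0 ≈ α m
    g0≈αm = trans (*-identityˡ _) (*-identityʳ _)
    delayed : ∀ k → convolve (newtonTerm m) (delay E) k ≈ (k × 1#) * e k m
    delayed zero    = trans (zeroʳ _) (sym (zeroˡ _))
    delayed (suc k) = trans (convolve-delayʳ k (newtonTerm m) E) (sym (newton m k))

  expand : ∀ Y X m → ∏[ r < m ] (Y - X * α r) ≈ HomogeneousForms.form S Y X (λ k → (- 1#) ^ k * e k m) m
  expand Y X zero    = sym (*-identityˡ 1#)
  expand Y X (suc m) = begin
    (∏[ r < m ] (Y - X * α r)) * (Y - X * α m) ≈⟨ *-congʳ (expand Y X m) ⟩
    form c m * (Y - X * α m)                   ≈⟨ distribute ⟩
    Y * form c m + (- α m) * (X * form c m)    ≈⟨ +-cong leading (*-congˡ (sym (form-delay m c))) ⟩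
    form c (suc m) + (- α m) * form (delay c) (suc m)   ≈⟨ +-congˡ (sym (form-*ˡ (suc m) (- α m) (delay c))) ⟩
    form c (suc m) + form (λ k → (- α m) * delay c k) (suc m)  ≈⟨ sym (form-+ (suc m) c _) ⟩
    form (λ k → c k + (- α m) * delay c k) (suc m)  ≈⟨ form-cong≤ (suc m) (λ k _ → coefficient k) ⟩
    form (λ k → (- 1#) ^ k * e k (suc m)) (suc m)    ∎
    where
    open HomogeneousForms S Y X
    c : ℕ → Carrier
    c k = (- 1#) ^ k * e k m
    distribute : form c m * (Y - X * α m) ≈ Y * form c m + (- α m) * (X * form c m)
    distribute = trans (*-congˡ (+-congˡ (-‿distribʳ-* X (α m))))
      (solve 4 (λ h y x na → h :* (y :+ x :* na) := y :* h :+ na :* (x :* h)) refl (form c m) Y X (- α m))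
    leading : Y * form c m ≈ form c (suc m)
    leading = sym (trans (+-congˡ (trans (*-congʳ (trans (*-congˡ (e-vanishes {m} ℕ.≤-refl)) (zeroʳ _))) (zeroˡ _)))
                         (+-identityʳ _))
    coefficient : ∀ k → c k + (- α m) * delay c k ≈ (- 1#) ^ k * e k (suc m)
    coefficient zero    = trans (+-congˡ (zeroʳ _)) (+-identityʳ _)
    coefficient (suc j) = begin
      (- 1#) * s * e (suc j) m + (- α m) * (s * e j m)
        ≈⟨ +-congˡ (*-congʳ (sym (-1*x≈-x (α m)))) ⟩
      (- 1#) * s * e (suc j) m + ((- 1#) * α m) * (s * e j m)
        ≈⟨ solve 5 (λ n s x a y → n :* s :* x :+ (n :* a) :* (s :* y) := n :* s :* (x :+ a :* y))
                   refl (- 1#) s (e (suc j) m) (α m) (e j m) ⟩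
      (- 1#) * s * (e (suc j) m + α m * e j m) ∎
      where s = (- 1#) ^ j

module PrependedSequence {a ℓ} (S : CommutativeRing a ℓ) (α : ℕ → CommutativeRing.Carrier S) where
  open CommutativeRing S
  open import Relation.Binary.Reasoning.Setoid setoid
  open import Algebra.Solver.Ring.NaturalCoefficients.Default commutativeSemiring
  module A = ElementarySymmetric S α
  module B = ElementarySymmetric S (λ r → α (suc r))

  e-prepend : ∀ m k → A.e (suc k) (suc m) ≈ B.e (suc k) m + α 0 * B.e k m
  e-prepend zero    zero    = refl
  e-prepend zero    (suc k) = refl
  e-prepend (suc m) k = begin
    A.e (suc k) (suc m) + α (suc m) * A.e k (suc m)  ≈⟨ +-cong (e-prepend m k) (*-congˡ (prepend′ k)) ⟩
    (B.e (suc k) m + α 0 * B.e k m) + α (suc m) * (B.e k m + α 0 * Convolution.delay S (λ j → B.e j m) k)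
      ≈⟨ solve 5 (λ x a₀ y aₘ z → (x :+ a₀ :* y) :+ aₘ :* (y :+ a₀ :* z) := (x :+ aₘ :* y) :+ a₀ :* (y :+ aₘ :* z))
                 refl (B.e (suc k) m) (α 0) (B.e k m) (α (suc m)) _ ⟩
    (B.e (suc k) m + α (suc m) * B.e k m) + α 0 * (B.e k m + α (suc m) * Convolution.delay S (λ j → B.e j m) k)
      ≈⟨ +-congˡ (*-congˡ (sym (B.e-suc m k))) ⟩
    B.e (suc k) (suc m) + α 0 * B.e k (suc m)  ∎
    where
    prepend′ : ∀ k → A.e k (suc m) ≈ B.e k m + α 0 * Convolution.delay S (λ j → B.e j m) k
    prepend′ zero    = sym (trans (+-congˡ (zeroʳ _)) (+-identityʳ _))
    prepend′ (suc j) = e-prepend m j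

module GeometricProgression {a ℓ} (S : CommutativeRing a ℓ) (q : CommutativeRing.Carrier S) where
  open CommutativeRing S
  open import Relation.Binary.Reasoning.Setoid setoid
  open import Algebra.Solver.Ring.NaturalCoefficients.Default commutativeSemiring
  open import Algebra.Properties.CommutativeSemiring.Exp commutativeSemiring
  open Convolution S using (delay)
  open ElementarySymmetric S (q ^_)

  -- Both sides are e_{k+1}(1, q, …, q^m): prepend 1 to q·(1, …, q^(m−1)), or append q^m.
  e-q-recursion : ∀ m k → q ^ suc k * e (suc k) m + q ^ k * e k m ≈ e (suc k) m + q ^ m * e k m
  e-q-recursion-delay : ∀ m k →
    q ^ suc k * e k m + q ^ k * delay (λ j → e j m) k ≈ q * e k m + q ^ suc m * delay (λ j → e j m) k

  e-q-recursion zero zero    = +-congʳ (zeroʳ _)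
  e-q-recursion zero (suc k) = trans (+-cong (zeroʳ _) (zeroʳ _)) (sym (+-congˡ (zeroʳ _)))
  e-q-recursion (suc m) k = begin
    q * qᵏ * (E₁ + qᵐ * E₀) + qᵏ * e k (suc m)      ≈⟨ +-congˡ (*-congˡ (e-suc m k)) ⟩
    q * qᵏ * (E₁ + qᵐ * E₀) + qᵏ * (E₀ + qᵐ * Ẽ)
      ≈⟨ solve 6 (λ q qk qm E1 E0 Et → q :* qk :* (E1 :+ qm :* E0) :+ qk :* (E0 :+ qm :* Et)
                      := (q :* qk :* E1 :+ qk :* E0) :+ qm :* (q :* qk :* E0 :+ qk :* Et)) refl q qᵏ qᵐ E₁ E₀ Ẽ ⟩
    (q * qᵏ * E₁ + qᵏ * E₀) + qᵐ * (q * qᵏ * E₀ + qᵏ * Ẽ)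
      ≈⟨ +-cong (e-q-recursion m k) (*-congˡ (e-q-recursion-delay m k)) ⟩
    (E₁ + qᵐ * E₀) + qᵐ * (q * E₀ + q * qᵐ * Ẽ)
      ≈⟨ solve 5 (λ q qm E1 E0 Et → (E1 :+ qm :* E0) :+ qm :* (q :* E0 :+ q :* qm :* Et)
                      := (E1 :+ qm :* E0) :+ q :* qm :* (E0 :+ qm :* Et)) refl q qᵐ E₁ E₀ Ẽ ⟩
    (E₁ + qᵐ * E₀) + q * qᵐ * (E₀ + qᵐ * Ẽ)         ≈⟨ +-congˡ (*-congˡ (sym (e-suc m k))) ⟩
    e (suc k) (suc m) + q * qᵐ * e k (suc m)         ∎
    where qᵏ = q ^ k ; qᵐ = q ^ m ; E₁ = e (suc k) m ; E₀ = e k m ; Ẽ = delay (λ j → e j m) k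

  e-q-recursion-delay m zero = +-cong (*-congʳ (*-identityʳ q)) (trans (zeroʳ _) (sym (zeroʳ _)))
  e-q-recursion-delay m (suc j) = begin
    q * (q * qʲ) * e (suc j) m + q * qʲ * e j m
      ≈⟨ solve 4 (λ q qj a b → q :* (q :* qj) :* a :+ q :* qj :* b := q :* (q :* qj :* a :+ qj :* b)) refl q qʲ _ _ ⟩
    q * (q * qʲ * e (suc j) m + qʲ * e j m)   ≈⟨ *-congˡ (e-q-recursion m j) ⟩
    q * (e (suc j) m + q ^ m * e j m)
      ≈⟨ solve 4 (λ q a qm b → q :* (a :+ qm :* b) := q :* a :+ q :* qm :* b) refl q _ (q ^ m) _ ⟩
    q * e (suc j) m + q * q ^ m * e j m       ∎
    where qʲ = q ^ j

module CoprimeMultiples {a ℓ} (S : CommutativeRing a ℓ) where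
  open CommutativeRing S
  open import Relation.Binary.Reasoning.Setoid setoid
  open import Algebra.Properties.Semiring.Mult semiring using (_×_; ×1-homo-*)

  open import Algebra.Solver.Ring.NaturalCoefficients.Default commutativeSemiring 

  bézout-multiples-vanish : ∀ m n u v x → 1 +ℕ u *ℕ m ≡ v *ℕ n →
    (m × 1#) * x ≈ 0# → (n × 1#) * x ≈ 0# → x ≈ 0#
  bézout-multiples-vanish m n u v x 1+um≡vn mx≈0 nx≈0 = begin
    x                                      ≈⟨ +-identityʳ x ⟨
    x + 0#                                 ≈⟨ +-congˡ (trans (*-congˡ mx≈0) (zeroʳ _)) ⟨
    x + (u × 1#) * ((m × 1#) * x)          ≈⟨ solve 3 (λ x u m → x :+ u :* (m :* x) := (con 1 :+ u :* m) :* x)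
                                                    refl x (u × 1#) (m × 1#) ⟩
    (1# + (u × 1#) * (m × 1#)) * x         ≈⟨ *-congʳ (+-congˡ (×1-homo-* u m)) ⟨
    ((1 +ℕ u *ℕ m) × 1#) * x               ≡⟨ ≡.cong (λ k → (k × 1#) * x) 1+um≡vn ⟩
    ((v *ℕ n) × 1#) * x                    ≈⟨ trans (*-congʳ (×1-homo-* v n)) (*-assoc _ _ x) ⟩
    (v × 1#) * ((n × 1#) * x)              ≈⟨ trans (*-congˡ nx≈0) (zeroʳ _) ⟩
    0#                                     ∎

  coprime-multiples-vanish : ∀ {m n} → Coprime m n → ∀ x →
    (m × 1#) * x ≈ 0# → (n × 1#) * x ≈ 0# → x ≈ 0#
  coprime-multiples-vanish {m} {n} m⊥n x mx≈0 nx≈0 with coprime-Bézout m⊥n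
  ... | Bézout.+- u v 1+vn≡um = bézout-multiples-vanish n m v u x 1+vn≡um nx≈0 mx≈0
  ... | Bézout.-+ u v 1+um≡vn = bézout-multiples-vanish m n u v x 1+um≡vn mx≈0 nx≈0

module PrimeCyclotomic {a ℓ} (S : CommutativeRing a ℓ) where
  open CommutativeRing S
  open import Relation.Binary.Reasoning.Setoid setoid
  open import Algebra.Properties.CommutativeSemiring.Exp commutativeSemiring
  open import Algebra.Properties.Semiring.Mult semiring using (_×_; ×-assoc-*; ×-congʳ)
  open import Algebra.Properties.Ring ring using (-‿involutive; -1*x≈-x; -‿distribˡ-*; -‿distribʳ-*)
  import Algebra.Properties.Group +-group as G⁺
  open FiniteSumsAndProducts S
  open GeometricSums S
  open Convolution S using (convolve-zeroˡ)
  open CoprimeMultiples S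

  module _ (p' : ℕ) (p-prime : Prime (suc p')) (ω : Carrier) (Φₚω≈0 : ∑[ i < suc p' ] ω ^ i ≈ 0#) where
    p : ℕ
    p = suc p'

    ω^p≈1 : ω ^ p ≈ 1#
    ω^p≈1 = G⁺.x∙y⁻¹≈ε⇒x≈y _ _ (begin
      ω ^ p - 1#                ≈⟨ +-congˡ (-‿cong (1^n≈1 p)) ⟨
      ω ^ p - 1# ^ p            ≈⟨ geom-telescope p ω 1# ⟨
      (ω - 1#) * geom p ω 1#    ≈⟨ *-congˡ (trans (geom-1ʳ p ω) Φₚω≈0) ⟩
      (ω - 1#) * 0#             ≈⟨ zeroʳ _ ⟩
      0#                        ∎)

    ω^-mod : ∀ x → ω ^ x ≈ ω ^ (x % p)
    ω^-mod x = begin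
      ω ^ x                              ≡⟨ ≡.cong (ω ^_) (m≡m%n+[m/n]*n x p) ⟩
      ω ^ (x % p +ℕ (x / p) *ℕ p)        ≈⟨ ^-homo-* ω (x % p) _ ⟩
      ω ^ (x % p) * ω ^ ((x / p) *ℕ p)   ≈⟨ *-congˡ (^-congʳ ω (ℕ.*-comm (x / p) p)) ⟩
      ω ^ (x % p) * ω ^ (p *ℕ (x / p))   ≈⟨ *-congˡ (^-assocʳ ω p (x / p)) ⟨
      ω ^ (x % p) * (ω ^ p) ^ (x / p)    ≈⟨ *-congˡ (trans (^-congˡ (x / p) ω^p≈1) (1^n≈1 (x / p))) ⟩
      ω ^ (x % p) * 1#                   ≈⟨ *-identityʳ _ ⟩
      ω ^ (x % p)                        ∎

    open ElementarySymmetric S (ω ^_)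

    powerSum-vanishes : ∀ {i} → 0 < i → i < p → powerSum i p ≈ 0#
    powerSum-vanishes {i} 0<i i<p = begin
      ∑[ b < p ] (ω ^ b) ^ i             ≈⟨ ∑-cong p (λ b → trans (^-assocʳ ω b i) (ω^-mod (b *ℕ i))) ⟩
      ∑[ b < p ] ω ^ ((b *ℕ i) % p)      ≈⟨ ∑-reindex p (ω ^_) (λ b → (b *ℕ i) % p) (λ b _ → m%n<n (b *ℕ i) p)
                                              (λ b b' b<p b'<p → *-cancel-mod-prime p p-prime 0<i i<p b<p b'<p) ⟩
      ∑[ b < p ] ω ^ b                   ≈⟨ Φₚω≈0 ⟩
      0#                                 ∎

    fixed⇒p·x≈0 : ∀ k x → ω ^ k * x ≈ x → powerSum k p ≈ 0# → (p × 1#) * x ≈ 0#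
    fixed⇒p·x≈0 k x ω^k·x≈x pₖ≈0 = begin
      (p × 1#) * x                  ≈⟨ trans (×-assoc-* p 1# x) (×-congʳ p (*-identityˡ x)) ⟩
      p × x                         ≈⟨ ∑-const p x ⟨
      ∑[ _ < p ] x                  ≈⟨ ∑-cong p (λ t → sym (fixed t)) ⟩
      ∑[ t < p ] (ω ^ t) ^ k * x    ≈⟨ ∑-distribʳ p _ x ⟨
      powerSum k p * x              ≈⟨ *-congʳ pₖ≈0 ⟩
      0# * x                        ≈⟨ zeroˡ x ⟩
      0#                            ∎
      where
      fixed : ∀ t → (ω ^ t) ^ k * x ≈ x
      fixed zero    = trans (*-congʳ (1^n≈1 k)) (*-identityˡ x)
      fixed (suc t) = begin
        (ω * ω ^ t) ^ k * x         ≈⟨ *-congʳ (^-distrib-* ω (ω ^ t) k) ⟩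
        (ω ^ k * (ω ^ t) ^ k) * x   ≈⟨ *-assoc _ _ _ ⟩
        ω ^ k * ((ω ^ t) ^ k * x)   ≈⟨ *-congˡ (fixed t) ⟩
        ω ^ k * x                   ≈⟨ ω^k·x≈x ⟩
        x                           ∎

    e-fixed : ∀ k → ω ^ k * e k p ≈ e k p
    e-fixed zero    = *-identityˡ _
    e-fixed (suc k) = G⁺.∙-cancelʳ (ω ^ k * e k p) _ _ (begin
      ω ^ suc k * e (suc k) p + ω ^ k * e k p  ≈⟨ GeometricProgression.e-q-recursion S ω p k ⟩
      e (suc k) p + ω ^ p * e k p              ≈⟨ +-congˡ (trans (*-congʳ ω^p≈1) (trans (*-identityˡ _) (sym (e-fixed k)))) ⟩
      e (suc k) p + ω ^ k * e k p              ∎)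

    -- k e_k = 0 by Newton, and p e_k = 0 because e_k is fixed by ω^k; k and p are coprime.
    e-vanishes-at-roots : ∀ {k} → 0 < k → k < p → e k p ≈ 0#
    e-vanishes-at-roots {suc k} 0<k k<p = coprime-multiples-vanish (prime⇒coprime p-prime k<p) _
      (fixed⇒p·x≈0 (suc k) _ (e-fixed (suc k)) (powerSum-vanishes 0<k k<p))
      (trans (newton p k) (convolve-zeroˡ k (newtonTerm p) _ (λ i i≤k →
        trans (*-congˡ (powerSum-vanishes (s≤s z≤n) (ℕ.≤-<-trans (s≤s i≤k) k<p))) (zeroʳ _))))

    module Nontrivial = ElementarySymmetric S (λ r → ω ^ suc r)

    signed-e-nontrivial : ∀ k → k ≤ p' → (- 1#) ^ k * Nontrivial.e k p' ≈ 1#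
    signed-e-nontrivial zero    _ = *-identityˡ 1#
    signed-e-nontrivial (suc k) k<p' = begin
      (- 1#) * s * Nontrivial.e (suc k) p'        ≈⟨ *-congˡ eₖ₊₁≈-eₖ ⟩
      (- 1#) * s * (- Nontrivial.e k p')          ≈⟨ *-congʳ (-1*x≈-x s) ⟩
      (- s) * (- Nontrivial.e k p')               ≈⟨ -‿distribˡ-* s _ ⟨
      - (s * (- Nontrivial.e k p'))               ≈⟨ -‿cong (-‿distribʳ-* s _) ⟨
      - (- (s * Nontrivial.e k p'))               ≈⟨ -‿involutive _ ⟩
      s * Nontrivial.e k p'                       ≈⟨ signed-e-nontrivial k (ℕ.<⇒≤ k<p') ⟩
      1#                                          ∎
      where
      s = (- 1#) ^ k
      eₖ₊₁+eₖ≈0 : Nontrivial.e (suc k) p' + Nontrivial.e k p' ≈ 0#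
      eₖ₊₁+eₖ≈0 = trans (+-congˡ (sym (*-identityˡ _)))
        (trans (sym (PrependedSequence.e-prepend S (ω ^_) p' k)) (e-vanishes-at-roots (s≤s z≤n) (s≤s k<p')))
      eₖ₊₁≈-eₖ : Nontrivial.e (suc k) p' ≈ - Nontrivial.e k p'
      eₖ₊₁≈-eₖ = G⁺.inverseʳ-unique _ _ (trans (+-comm _ _) eₖ₊₁+eₖ≈0)

    ∏-nontrivial-roots : ∀ Y X → ∏[ r < p' ] (Y - X * ω ^ suc r) ≈ geom p Y X
    ∏-nontrivial-roots Y X = begin
      ∏[ r < p' ] (Y - X * ω ^ suc r)                  ≈⟨ Nontrivial.expand Y X p' ⟩
      form (λ k → (- 1#) ^ k * Nontrivial.e k p') p'   ≈⟨ form-cong≤ p' signed-e-nontrivial ⟩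
      form (λ _ → 1#) p'                               ≈⟨ form-1 p' ⟩
      geom p Y X                                       ∎
      where open HomogeneousForms S Y X

module PrimePowerCyclotomic {a ℓ} (S : CommutativeRing a ℓ) (p' : ℕ) (p-prime : Prime (suc p')) where
  open CommutativeRing S
  open import Relation.Binary.Reasoning.Setoid setoid
  open import Algebra.Solver.Ring.NaturalCoefficients.Default commutativeSemiring
  open import Algebra.Properties.CommutativeSemiring.Exp commutativeSemiring
  open FiniteSumsAndProducts S
  open GeometricSums S
  open PrimeCyclotomic S using (∏-nontrivial-roots)

  p : ℕ
  p = suc p'

  NontrivialRootsProduct : ℕ → Carrier → Set (a ⊔ ℓ)
  NontrivialRootsProduct L' ζ = ∀ Y X → ∏[ i < L' ] (Y - X * ζ ^ suc i) ≈ geom (suc L') Y X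

  ∏-all-roots : ∀ {L' ζ} → NontrivialRootsProduct L' ζ →
    ∀ Y X → ∏[ i < suc L' ] (Y - X * ζ ^ i) ≈ Y ^ suc L' - X ^ suc L'
  ∏-all-roots {L'} {ζ} ∏≈geom Y X = begin
    ∏[ i < suc L' ] (Y - X * ζ ^ i)                 ≈⟨ ∏-unfoldˡ L' _ ⟩
    (Y - X * 1#) * (∏[ i < L' ] (Y - X * ζ ^ suc i)) ≈⟨ *-cong (+-congˡ (-‿cong (*-identityʳ X))) (∏≈geom Y X) ⟩
    (Y - X) * geom (suc L') Y X                     ≈⟨ geom-telescope (suc L') Y X ⟩
    Y ^ suc L' - X ^ suc L'                         ∎

  p-adic-step : ∀ L' ζ → NontrivialRootsProduct L' (ζ ^ p) → ∑[ i < p ] (ζ ^ suc L') ^ i ≈ 0# →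
    NontrivialRootsProduct (p' +ℕ p *ℕ L') ζ
  p-adic-step L' ζ IH Φₚω≈0 Y X = begin
    ∏[ i < p' +ℕ p *ℕ L' ] g (suc i)                   ≈⟨ *-identityˡ _ ⟨
    g 0 * (∏[ i < p' +ℕ p *ℕ L' ] g (suc i))           ≈⟨ ∏-unfoldˡ (p' +ℕ p *ℕ L') g ⟨
    ∏ (suc (p' +ℕ p *ℕ L')) g                          ≡⟨ ≡.cong (λ n → ∏ n g) (p-adic-count p' L') ⟩
    ∏ (p *ℕ L) g                                       ≈⟨ ∏-blocks p L g ⟩
    ∏[ a < L ] ∏[ r < p ] g (p *ℕ a +ℕ r)              ≈⟨ ∏-comm L p _ ⟩
    ∏[ r < p ] ∏[ a < L ] g (p *ℕ a +ℕ r)              ≈⟨ ∏-unfoldˡ p' _ ⟩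
    (∏[ a < L ] g (p *ℕ a +ℕ 0)) * (∏[ r < p' ] ∏[ a < L ] g (p *ℕ a +ℕ suc r))
                                                        ≈⟨ *-cong residue-zero (∏-cong p' residue-nonzero) ⟩
    geom L Y X * (∏[ r < p' ] (Y ^ L - X ^ L * ω ^ suc r))
                                                        ≈⟨ *-congˡ (∏-nontrivial-roots p' p-prime ω Φₚω≈0 (Y ^ L) (X ^ L)) ⟩
    geom L Y X * geom p (Y ^ L) (X ^ L)                 ≈⟨ geom-* L p Y X ⟨
    geom (L *ℕ p) Y X                                   ≡⟨ ≡.cong (λ n → geom n Y X) (≡.trans (ℕ.*-comm L p) (≡.sym (p-adic-count p' L'))) ⟩
    geom (suc (p' +ℕ p *ℕ L')) Y X                      ∎
    where
    L = suc L'
    ω = ζ ^ L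
    g : ℕ → Carrier
    g zero    = 1#
    g (suc i) = Y - X * ζ ^ suc i
    g-≡ : ∀ {i j} → i ≡ j → g i ≈ g j
    g-≡ ≡.refl = refl
    residue-zero : ∏[ a < L ] g (p *ℕ a +ℕ 0) ≈ geom L Y X
    residue-zero = begin
      ∏[ a < L ] g (p *ℕ a +ℕ 0)                           ≈⟨ ∏-unfoldˡ L' _ ⟩
      g (p *ℕ 0 +ℕ 0) * (∏[ a < L' ] g (p *ℕ suc a +ℕ 0))  ≈⟨ *-cong (g-≡ {j = 0} p*0+0≡0) (∏-cong L' g-multiple) ⟩
      1# * (∏[ a < L' ] (Y - X * (ζ ^ p) ^ suc a))         ≈⟨ *-identityˡ _ ⟩
      ∏[ a < L' ] (Y - X * (ζ ^ p) ^ suc a)                ≈⟨ IH Y X ⟩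
      geom L Y X                                           ∎
      where
      p*0+0≡0 : p *ℕ 0 +ℕ 0 ≡ 0
      p*0+0≡0 = ≡.trans (ℕ.+-identityʳ _) (ℕ.*-zeroʳ p)
      g-multiple : ∀ a → g (p *ℕ suc a +ℕ 0) ≈ Y - X * (ζ ^ p) ^ suc a
      g-multiple a = +-congˡ (-‿cong (*-congˡ (trans (^-congʳ ζ (ℕ.+-identityʳ (p *ℕ suc a))) (sym (^-assocʳ ζ p (suc a))))))
    residue-nonzero : ∀ r → ∏[ a < L ] g (p *ℕ a +ℕ suc r) ≈ Y ^ L - X ^ L * ω ^ suc r
    residue-nonzero r = begin
      ∏[ a < L ] g (p *ℕ a +ℕ suc r)                    ≈⟨ ∏-cong L (λ a → trans (g-≡ (ℕ.+-suc (p *ℕ a) r)) (+-congˡ (-‿cong (shift a)))) ⟩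
      ∏[ a < L ] (Y - (X * ζ ^ suc r) * (ζ ^ p) ^ a)     ≈⟨ ∏-all-roots {L'} IH Y (X * ζ ^ suc r) ⟩
      Y ^ L - (X * ζ ^ suc r) ^ L                        ≈⟨ +-congˡ (-‿cong (trans (^-distrib-* X _ L) (*-congˡ rotate))) ⟩
      Y ^ L - X ^ L * ω ^ suc r                          ∎
      where
      shift : ∀ a → X * ζ ^ suc (p *ℕ a +ℕ r) ≈ (X * ζ ^ suc r) * (ζ ^ p) ^ a
      shift a = begin
        X * ζ ^ suc (p *ℕ a +ℕ r)            ≡⟨ ≡.cong (λ n → X * ζ ^ n) (≡.sym (ℕ.+-suc (p *ℕ a) r)) ⟩
        X * ζ ^ (p *ℕ a +ℕ suc r)            ≈⟨ *-congˡ (^-homo-* ζ (p *ℕ a) (suc r)) ⟩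
        X * (ζ ^ (p *ℕ a) * ζ ^ suc r)       ≈⟨ *-congˡ (*-congʳ (^-assocʳ ζ p a)) ⟨
        X * ((ζ ^ p) ^ a * ζ ^ suc r)        ≈⟨ solve 3 (λ x a b → x :* (a :* b) := (x :* b) :* a) refl X _ _ ⟩
        (X * ζ ^ suc r) * (ζ ^ p) ^ a        ∎
      rotate : (ζ ^ suc r) ^ L ≈ ω ^ suc r
      rotate = trans (^-assocʳ ζ (suc r) L) (trans (^-congʳ ζ (ℕ.*-comm (suc r) L)) (sym (^-assocʳ ζ L (suc r))))

  p^-pred : ℕ → ℕ
  p^-pred zero    = p'
  p^-pred (suc k) = p' +ℕ p *ℕ p^-pred k

  suc-p^-pred : ∀ k → suc (p^-pred k) ≡ p ^ℕ suc k
  suc-p^-pred zero    = ≡.sym (ℕ.*-identityʳ p)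
  suc-p^-pred (suc k) = ≡.trans (p-adic-count p' (p^-pred k)) (≡.cong (p *ℕ_) (suc-p^-pred k))

  cyclotomic-∏ : ∀ k ζ → ∑[ i < p ] ζ ^ (i *ℕ p ^ℕ k) ≈ 0# → NontrivialRootsProduct (p^-pred k) ζ
  cyclotomic-∏ zero ζ Φζ≈0 =
    ∏-nontrivial-roots p' p-prime ζ (trans (∑-cong p (λ i → ^-congʳ ζ (≡.sym (ℕ.*-identityʳ i)))) Φζ≈0)
  cyclotomic-∏ (suc k) ζ Φζ≈0 = p-adic-step (p^-pred k) ζ (cyclotomic-∏ k (ζ ^ p) Φζ^p≈0) Φω≈0
    where
    Φζ^p≈0 : ∑[ i < p ] (ζ ^ p) ^ (i *ℕ p ^ℕ k) ≈ 0#
    Φζ^p≈0 = trans (∑-cong p (λ i → trans (^-assocʳ ζ p (i *ℕ p ^ℕ k)) (^-congʳ ζ (ℕ*.x∙yz≈y∙xz p i (p ^ℕ k))))) Φζ≈0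
    Φω≈0 : ∑[ i < p ] (ζ ^ suc (p^-pred k)) ^ i ≈ 0#
    Φω≈0 = trans (∑-cong p (λ i → trans (^-assocʳ ζ (suc (p^-pred k)) i)
      (^-congʳ ζ (≡.trans (ℕ.*-comm _ i) (≡.cong (i *ℕ_) (suc-p^-pred k)))))) Φζ≈0

-- Polynomials in σ acting on a finite module

module AdditiveMap {r ℓr m ℓm} {R : CommutativeRing r ℓr} (M : Module R m ℓm) where
  open Module M
  open import Relation.Binary.Reasoning.Setoid ≈ᴹ-setoid
  import Algebra.Properties.Group +ᴹ-group as Gᴹ

  module _ (f : Carrierᴹ → Carrierᴹ) (f-cong : ∀ {x y} → x ≈ᴹ y → f x ≈ᴹ f y)
           (f-+ : ∀ x y → f (x +ᴹ y) ≈ᴹ f x +ᴹ f y) where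

    map-0 : f 0ᴹ ≈ᴹ 0ᴹ
    map-0 = Gᴹ.∙-cancelˡ (f 0ᴹ) _ _ (begin
      f 0ᴹ +ᴹ f 0ᴹ     ≈⟨ f-+ 0ᴹ 0ᴹ ⟨
      f (0ᴹ +ᴹ 0ᴹ)     ≈⟨ f-cong (+ᴹ-identityʳ 0ᴹ) ⟩
      f 0ᴹ             ≈⟨ +ᴹ-identityʳ _ ⟨
      f 0ᴹ +ᴹ 0ᴹ       ∎)

    map-neg : ∀ x → f (-ᴹ x) ≈ᴹ -ᴹ f x
    map-neg x = Gᴹ.inverseʳ-unique (f x) (f (-ᴹ x))
      (≈ᴹ-trans (≈ᴹ-sym (f-+ x (-ᴹ x))) (≈ᴹ-trans (f-cong (-ᴹ‿inverseʳ x)) map-0))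

module OperatorRing {r ℓr m ℓm} {R : CommutativeRing r ℓr} (M : Module R m ℓm)
                    {N : ℕ} (G : CyclicAction M N) where
  open CommutativeRing R using (Carrier; refl; *-comm; 0#; 1#)
  open Module M
  open CyclicAction G
  import Algebra.Properties.AbelianGroup +ᴹ-abelianGroup as AG
  open import Algebra.Properties.CommutativeSemigroup (AbelianGroup.commutativeSemigroup +ᴹ-abelianGroup) using (interchange)
  open AdditiveMap M

  infixl 6 _⊕_
  infixl 7 _⊗_
  infix  8 ⊖_
  -- Polynomials in σ with coefficients in R, kept as syntax: any two of them commute on M, so
  -- they form a commutative ring under pointwise equality.
  data Operator : Set r where
    scalar : Carrier → Operator
    σ̂      : Operator
    _⊕_    : Operator → Operator → Operator
    _⊗_    : Operator → Operator → Operator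
    ⊖_     : Operator → Operator

  ⟦_⟧ : Operator → Carrierᴹ → Carrierᴹ
  ⟦ scalar a ⟧ x = a *ₗ x
  ⟦ σ̂ ⟧        x = σ x
  ⟦ A ⊕ B ⟧    x = ⟦ A ⟧ x +ᴹ ⟦ B ⟧ x
  ⟦ A ⊗ B ⟧    x = ⟦ A ⟧ (⟦ B ⟧ x)
  ⟦ ⊖ A ⟧      x = -ᴹ ⟦ A ⟧ x

  ⟦⟧-cong : ∀ A {x y} → x ≈ᴹ y → ⟦ A ⟧ x ≈ᴹ ⟦ A ⟧ y
  ⟦⟧-cong (scalar a) x≈y = *ₗ-cong refl x≈y
  ⟦⟧-cong σ̂          x≈y = σ-cong x≈y
  ⟦⟧-cong (A ⊕ B)    x≈y = +ᴹ-cong (⟦⟧-cong A x≈y) (⟦⟧-cong B x≈y)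
  ⟦⟧-cong (A ⊗ B)    x≈y = ⟦⟧-cong A (⟦⟧-cong B x≈y)
  ⟦⟧-cong (⊖ A)      x≈y = -ᴹ‿cong (⟦⟧-cong A x≈y)

  ⟦⟧-+ : ∀ A x y → ⟦ A ⟧ (x +ᴹ y) ≈ᴹ ⟦ A ⟧ x +ᴹ ⟦ A ⟧ y
  ⟦⟧-+ (scalar a) x y = *ₗ-distribˡ a x y
  ⟦⟧-+ σ̂          x y = σ-+ x y
  ⟦⟧-+ (A ⊕ B)    x y = ≈ᴹ-trans (+ᴹ-cong (⟦⟧-+ A x y) (⟦⟧-+ B x y)) (interchange _ _ _ _)
  ⟦⟧-+ (A ⊗ B)    x y = ≈ᴹ-trans (⟦⟧-cong A (⟦⟧-+ B x y)) (⟦⟧-+ A _ _)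
  ⟦⟧-+ (⊖ A)      x y = ≈ᴹ-trans (-ᴹ‿cong (⟦⟧-+ A x y)) (≈ᴹ-sym (AG.⁻¹-∙-comm _ _))

  ⟦⟧-0 : ∀ A → ⟦ A ⟧ 0ᴹ ≈ᴹ 0ᴹ
  ⟦⟧-0 A = map-0 ⟦ A ⟧ (⟦⟧-cong A) (⟦⟧-+ A)

  ⟦⟧-neg : ∀ A x → ⟦ A ⟧ (-ᴹ x) ≈ᴹ -ᴹ ⟦ A ⟧ x
  ⟦⟧-neg A = map-neg ⟦ A ⟧ (⟦⟧-cong A) (⟦⟧-+ A)

  ⟦⟧-*ₗ : ∀ A c x → ⟦ A ⟧ (c *ₗ x) ≈ᴹ c *ₗ ⟦ A ⟧ x
  ⟦⟧-*ₗ (scalar a) c x = ≈ᴹ-trans (≈ᴹ-sym (*ₗ-assoc a c x)) (≈ᴹ-trans (*ₗ-cong (*-comm a c) ≈ᴹ-refl) (*ₗ-assoc c a x))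
  ⟦⟧-*ₗ σ̂          c x = σ-*ₗ c x
  ⟦⟧-*ₗ (A ⊕ B)    c x = ≈ᴹ-trans (+ᴹ-cong (⟦⟧-*ₗ A c x) (⟦⟧-*ₗ B c x)) (≈ᴹ-sym (*ₗ-distribˡ c _ _))
  ⟦⟧-*ₗ (A ⊗ B)    c x = ≈ᴹ-trans (⟦⟧-cong A (⟦⟧-*ₗ B c x)) (⟦⟧-*ₗ A c _)
  ⟦⟧-*ₗ (⊖ A)      c x = ≈ᴹ-trans (-ᴹ‿cong (⟦⟧-*ₗ A c x)) (≈ᴹ-sym (map-neg (c *ₗ_) (*ₗ-cong refl) (*ₗ-distribˡ c) _))

  ⟦⟧-σ : ∀ A x → ⟦ A ⟧ (σ x) ≈ᴹ σ (⟦ A ⟧ x)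
  ⟦⟧-σ (scalar a) x = ≈ᴹ-sym (σ-*ₗ a x)
  ⟦⟧-σ σ̂          x = ≈ᴹ-refl
  ⟦⟧-σ (A ⊕ B)    x = ≈ᴹ-trans (+ᴹ-cong (⟦⟧-σ A x) (⟦⟧-σ B x)) (≈ᴹ-sym (σ-+ _ _))
  ⟦⟧-σ (A ⊗ B)    x = ≈ᴹ-trans (⟦⟧-cong A (⟦⟧-σ B x)) (⟦⟧-σ A _)
  ⟦⟧-σ (⊖ A)      x = ≈ᴹ-trans (-ᴹ‿cong (⟦⟧-σ A x)) (≈ᴹ-sym (map-neg σ σ-cong σ-+ _))

  ⟦⟧-comm : ∀ A B x → ⟦ A ⟧ (⟦ B ⟧ x) ≈ᴹ ⟦ B ⟧ (⟦ A ⟧ x)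
  ⟦⟧-comm A (scalar c) x = ⟦⟧-*ₗ A c x
  ⟦⟧-comm A σ̂          x = ⟦⟧-σ A x
  ⟦⟧-comm A (B ⊕ C)    x = ≈ᴹ-trans (⟦⟧-+ A _ _) (+ᴹ-cong (⟦⟧-comm A B x) (⟦⟧-comm A C x))
  ⟦⟧-comm A (B ⊗ C)    x = ≈ᴹ-trans (⟦⟧-comm A B _) (⟦⟧-cong B (⟦⟧-comm A C x))
  ⟦⟧-comm A (⊖ B)      x = ≈ᴹ-trans (⟦⟧-neg A _) (-ᴹ‿cong (⟦⟧-comm A B x))

  infix 4 _≋_
  record _≋_ (A B : Operator) : Set (m ⊔ ℓm) where
    constructor pointwise
    field at : ∀ x → ⟦ A ⟧ x ≈ᴹ ⟦ B ⟧ x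
  open _≋_ public

  operatorRing : CommutativeRing r (m ⊔ ℓm)
  operatorRing = record { isCommutativeRing = isCommutativeRing }
    where
    isCommutativeRing : IsCommutativeRing _≋_ _⊕_ _⊗_ ⊖_ (scalar 0#) (scalar 1#)
    isCommutativeRing = record
      { isRing = record
        { +-isAbelianGroup = record
          { isGroup = record
            { isMonoid = record
              { isSemigroup = record
                { isMagma = record
                  { isEquivalence = record
                    { refl  = pointwise (λ x → ≈ᴹ-refl)
                    ; sym   = λ A≋B → pointwise (λ x → ≈ᴹ-sym (at A≋B x))
                    ; trans = λ A≋B B≋C → pointwise (λ x → ≈ᴹ-trans (at A≋B x) (at B≋C x)) }
                  ; ∙-cong = λ A≋B C≋D → pointwise (λ x → +ᴹ-cong (at A≋B x) (at C≋D x)) }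
                ; assoc = λ A B C → pointwise (λ x → +ᴹ-assoc _ _ _) }
              ; identity = (λ A → pointwise (λ x → ≈ᴹ-trans (+ᴹ-congʳ (*ₗ-zeroˡ x)) (+ᴹ-identityˡ _)))
                         , (λ A → pointwise (λ x → ≈ᴹ-trans (+ᴹ-congˡ (*ₗ-zeroˡ x)) (+ᴹ-identityʳ _))) }
            ; inverse = (λ A → pointwise (λ x → ≈ᴹ-trans (-ᴹ‿inverseˡ _) (≈ᴹ-sym (*ₗ-zeroˡ x))))
                      , (λ A → pointwise (λ x → ≈ᴹ-trans (-ᴹ‿inverseʳ _) (≈ᴹ-sym (*ₗ-zeroˡ x))))
            ; ⁻¹-cong = λ A≋B → pointwise (λ x → -ᴹ‿cong (at A≋B x)) }
          ; comm = λ A B → pointwise (λ x → +ᴹ-comm _ _) }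
        ; *-cong = λ {A} A≋B C≋D → pointwise (λ x → ≈ᴹ-trans (⟦⟧-cong A (at C≋D x)) (at A≋B _))
        ; *-assoc = λ A B C → pointwise (λ x → ≈ᴹ-refl)
        ; *-identity = (λ A → pointwise (λ x → *ₗ-identityˡ _))
                     , (λ A → pointwise (λ x → ⟦⟧-cong A (*ₗ-identityˡ x)))
        ; distrib = (λ A B C → pointwise (λ x → ⟦⟧-+ A _ _))
                  , (λ A B C → pointwise (λ x → ≈ᴹ-refl)) }
      ; *-comm = λ A B → pointwise (λ x → ⟦⟧-comm A B x) }

module OperatorCalculus {r ℓr m ℓm} {R : CommutativeRing r ℓr} (M : Module R m ℓm)
                        {N : ℕ} (G : CyclicAction M N) where
  open OperatorRing M G public
  open CommutativeRing operatorRing public using (_≈_; _+_; _*_; -_; _-_; 0#; 1#)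
  open import Algebra.Properties.CommutativeSemiring.Exp (CommutativeRing.commutativeSemiring operatorRing) public
    using (_^_)
  open FiniteSumsAndProducts operatorRing public using (∑; ∏)
  private
    module R = CommutativeRing R
  open Module M
  open CyclicAction G

  scalar-cong : ∀ {a b} → a R.≈ b → scalar a ≈ scalar b
  scalar-cong a≈b = pointwise (λ x → *ₗ-cong a≈b ≈ᴹ-refl)

  scalar-powR : ∀ a k → scalar (powR R a k) ≈ scalar a ^ k
  scalar-powR a zero    = pointwise (λ x → ≈ᴹ-refl)
  scalar-powR a (suc k) = pointwise (λ x → ≈ᴹ-trans (*ₗ-assoc a _ x) (*ₗ-cong R.refl (at (scalar-powR a k) x)))

  scalar-sumR : ∀ n f → scalar (sumR R n f) ≈ ∑ n (λ i → scalar (f i))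
  scalar-sumR zero    f = pointwise (λ x → ≈ᴹ-refl)
  scalar-sumR (suc n) f = pointwise (λ x → ≈ᴹ-trans (*ₗ-distribʳ x _ _) (+ᴹ-congʳ (at (scalar-sumR n f) x)))

  ⟦σ̂^⟧ : ∀ k x → ⟦ σ̂ ^ k ⟧ x ≈ᴹ iter M σ k x
  ⟦σ̂^⟧ zero    x = *ₗ-identityˡ x
  ⟦σ̂^⟧ (suc k) x = σ-cong (⟦σ̂^⟧ k x)

  ⟦∑⟧ : ∀ n f x → ⟦ ∑ n f ⟧ x ≈ᴹ sumM M n (λ i → ⟦ f i ⟧ x)
  ⟦∑⟧ zero    f x = *ₗ-zeroˡ x
  ⟦∑⟧ (suc n) f x = +ᴹ-congʳ (⟦∑⟧ n f x)

  σ̂^N≈1 : σ̂ ^ N ≈ 1#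
  σ̂^N≈1 = pointwise (λ x → ≈ᴹ-trans (⟦σ̂^⟧ N x) (≈ᴹ-trans (σ-order x) (≈ᴹ-sym (*ₗ-identityˡ x))))

  ⟦^⟧-agree : ∀ A B x → ⟦ A ⟧ x ≈ᴹ ⟦ B ⟧ x → ∀ t → ⟦ A ^ t ⟧ x ≈ᴹ ⟦ B ^ t ⟧ x
  ⟦^⟧-agree A B x Ax≈Bx zero    = ≈ᴹ-refl
  ⟦^⟧-agree A B x Ax≈Bx (suc t) = ≈ᴹ-trans (⟦⟧-cong A (⟦^⟧-agree A B x Ax≈Bx t))
    (≈ᴹ-trans (⟦⟧-comm A (B ^ t) x) (≈ᴹ-trans (⟦⟧-cong (B ^ t) Ax≈Bx) (⟦⟧-comm (B ^ t) B x)))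

  ⟦^⟧-fixes : ∀ A w → ⟦ A ⟧ w ≈ᴹ w → ∀ t → ⟦ A ^ t ⟧ w ≈ᴹ w
  ⟦^⟧-fixes A w Aw≈w zero    = *ₗ-identityˡ w
  ⟦^⟧-fixes A w Aw≈w (suc t) = ≈ᴹ-trans (⟦⟧-cong A (⟦^⟧-fixes A w Aw≈w t)) Aw≈w

module FiniteCounting {r ℓr m ℓm} {R : CommutativeRing r ℓr} (M : Module R m ℓm) (fin : Finite M) where
  open import Data.Product using (_×_)
  open Module M
  open HasCard
  open AdditiveMap M using (map-neg)
  import Algebra.Properties.Group +ᴹ-group as Gᴹ

  private
    K = proj₁ fin
    enum : Fin K → Carrierᴹ
    enum = elt (proj₂ fin)
    position : Carrierᴹ → Fin K
    position x = proj₁ (elt-sur (proj₂ fin) x tt)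
    enum-position : ∀ x → enum (position x) ≈ᴹ x
    enum-position x = proj₂ (elt-sur (proj₂ fin) x tt)

  _≟ᴹ_ : ∀ x y → Dec (x ≈ᴹ y)
  x ≟ᴹ y with position x Fin.≟ position y
  ... | yes e = yes (≈ᴹ-trans (≈ᴹ-sym (enum-position x)) (≈ᴹ-trans (≈ᴹ-reflexive (≡.cong enum e)) (enum-position y)))
  ... | no ne = no (λ x≈y → ne (elt-inj (proj₂ fin) _ _
                  (≈ᴹ-trans (enum-position x) (≈ᴹ-trans x≈y (≈ᴹ-sym (enum-position y))))))

  Respects≈ᴹ : ∀ {ℓp} → (Carrierᴹ → Set ℓp) → Set _
  Respects≈ᴹ P = ∀ {x y} → x ≈ᴹ y → P x → P y

  ∃? : ∀ {ℓp} (P : Carrierᴹ → Set ℓp) → Respects≈ᴹ P → (∀ x → Dec (P x)) → Dec (Σ Carrierᴹ P)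
  ∃? P P-resp P? with Fin.any? (λ i → P? (enum i))
  ... | yes (i , Pi) = yes (enum i , Pi)
  ... | no ¬∃i = no (λ { (x , Px) → ¬∃i (position x , P-resp (≈ᴹ-sym (enum-position x)) Px) })

  count : ∀ {ℓp} (P : Carrierᴹ → Set ℓp) → Respects≈ᴹ P → (∀ x → Dec (P x)) → Σ ℕ (HasCard M P)
  count P P-resp P? = size , record
    { elt     = λ i → enum (index i)
    ; elt-in  = index-in
    ; elt-inj = λ i j e → index-inj i j (elt-inj (proj₂ fin) _ _ e)
    ; elt-sur = λ x Px → let j , e = index-sur (position x) (P-resp (≈ᴹ-sym (enum-position x)) Px)
                          in j , ≈ᴹ-trans (≈ᴹ-reflexive (≡.cong enum e)) (enum-position x) }
    where open Enumeration (enumerate K (λ i → P (enum i)) (λ i → P? (enum i)))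

  module Embedding {ℓp ℓq} {P : Carrierᴹ → Set ℓp} {Q : Carrierᴹ → Set ℓq} {a b : ℕ}
                   (#P : HasCard M P a) (#Q : HasCard M Q b) (P⊆Q : ∀ x → P x → Q x) where
    embed : Fin a → Fin b
    embed i = proj₁ (elt-sur #Q (elt #P i) (P⊆Q _ (elt-in #P i)))

    embed-elt : ∀ i → elt #Q (embed i) ≈ᴹ elt #P i
    embed-elt i = proj₂ (elt-sur #Q (elt #P i) (P⊆Q _ (elt-in #P i)))

    embed-inj : ∀ i j → embed i ≡ embed j → i ≡ j
    embed-inj i j e = elt-inj #P i j
      (≈ᴹ-trans (≈ᴹ-sym (embed-elt i)) (≈ᴹ-trans (≈ᴹ-reflexive (≡.cong (elt #Q) e)) (embed-elt j)))

  HasCard-mono : ∀ {ℓp ℓq} {P : Carrierᴹ → Set ℓp} {Q : Carrierᴹ → Set ℓq} {a b} →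
    HasCard M P a → HasCard M Q b → (∀ x → P x → Q x) → a ≤ b
  HasCard-mono #P #Q P⊆Q = Fin.injective⇒≤ {f = embed} (λ {i} {j} → embed-inj i j)
    where open Embedding #P #Q P⊆Q

  HasCard-⊆⇒⊇ : ∀ {ℓp ℓq} {P : Carrierᴹ → Set ℓp} {Q : Carrierᴹ → Set ℓq} {a} → Respects≈ᴹ P →
    HasCard M P a → HasCard M Q a → (∀ x → P x → Q x) → ∀ x → Q x → P x
  HasCard-⊆⇒⊇ P-resp #P #Q P⊆Q x Qx = P-resp (≈ᴹ-trans (≈ᴹ-sym (embed-elt i)) elt-embed-i≈x) (elt-in #P i)
    where
    open Embedding #P #Q P⊆Q
    j = proj₁ (elt-sur #Q x Qx)
    i = proj₁ (Fin-injective⇒surjective embed embed-inj j)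
    elt-embed-i≈x : elt #Q (embed i) ≈ᴹ x
    elt-embed-i≈x = ≈ᴹ-trans (≈ᴹ-reflexive (≡.cong (elt #Q) (proj₂ (Fin-injective⇒surjective embed embed-inj j))))
                             (proj₂ (elt-sur #Q x Qx))

  HasCard-unique : ∀ {ℓp ℓq} {P : Carrierᴹ → Set ℓp} {Q : Carrierᴹ → Set ℓq} {a b} →
    HasCard M P a → HasCard M Q b → (∀ x → P x → Q x) → (∀ x → Q x → P x) → a ≡ b
  HasCard-unique #P #Q P⊆Q Q⊆P = ℕ.≤-antisym (HasCard-mono #P #Q P⊆Q) (HasCard-mono #Q #P Q⊆P)

  HasCard-transfer : ∀ {ℓp ℓq} {P : Carrierᴹ → Set ℓp} {Q : Carrierᴹ → Set ℓq} {a} →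
    (∀ x → P x → Q x) → (∀ x → Q x → P x) → HasCard M P a → HasCard M Q a
  HasCard-transfer P⊆Q Q⊆P #P = record
    { elt = elt #P ; elt-in = λ i → P⊆Q _ (elt-in #P i) ; elt-inj = elt-inj #P
    ; elt-sur = λ x Qx → elt-sur #P x (Q⊆P x Qx) }

  HasCard-inhabited : ∀ {ℓp} {P : Carrierᴹ → Set ℓp} {a} → HasCard M P a → ∀ x → P x → 1 ≤ a
  HasCard-inhabited {a = zero}  #P x Px with () ← proj₁ (elt-sur #P x Px)
  HasCard-inhabited {a = suc a} #P x Px = s≤s z≤n

  HasCard-zero : HasCard M (_≈ᴹ 0ᴹ) 1
  HasCard-zero = record
    { elt = λ _ → 0ᴹ ; elt-in = λ _ → ≈ᴹ-refl
    ; elt-inj = λ { fzero fzero _ → ≡.refl } ; elt-sur = λ x x≈0 → fzero , ≈ᴹ-sym x≈0 }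

  rank-nullity : ∀ {ℓa} (A : Carrierᴹ → Set ℓa) → (∀ {x y} → A x → A y → A (x +ᴹ y)) → (∀ {x} → A x → A (-ᴹ x)) →
    (f : Carrierᴹ → Carrierᴹ) → (∀ {x y} → x ≈ᴹ y → f x ≈ᴹ f y) → (∀ x y → f (x +ᴹ y) ≈ᴹ f x +ᴹ f y) →
    ∀ {a k i} → HasCard M A a → HasCard M (λ x → A x × f x ≈ᴹ 0ᴹ) k →
    HasCard M (λ y → Σ Carrierᴹ (λ x → A x × f x ≈ᴹ y)) i → a ≡ k *ℕ i
  rank-nullity A A-+ A-neg f f-cong f-+ {a} {k} {i} #A #ker #im = HasCard-unique #A #ker×im (λ _ Ax → Ax) (λ _ Ax → Ax)
    where
    lift : Fin i → Carrierᴹ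
    lift j = proj₁ (elt-in #im j)
    lift-A : ∀ j → A (lift j)
    lift-A j = proj₁ (proj₂ (elt-in #im j))
    f-lift : ∀ j → f (lift j) ≈ᴹ elt #im j
    f-lift j = proj₂ (proj₂ (elt-in #im j))
    pair : Fin k → Fin i → Carrierᴹ
    pair u j = elt #ker u +ᴹ lift j
    f-pair : ∀ u j → f (pair u j) ≈ᴹ elt #im j
    f-pair u j = ≈ᴹ-trans (f-+ _ _) (≈ᴹ-trans (+ᴹ-cong (proj₂ (elt-in #ker u)) (f-lift j)) (+ᴹ-identityˡ _))
    pair-inj : ∀ u j u' j' → pair u j ≈ᴹ pair u' j' → (u , j) ≡ (u' , j')
    pair-inj u j u' j' e with elt-inj #im j j' (≈ᴹ-trans (≈ᴹ-sym (f-pair u j)) (≈ᴹ-trans (f-cong e) (f-pair u' j')))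
    ... | ≡.refl with elt-inj #ker u u' (Gᴹ.∙-cancelʳ (lift j) _ _ e)
    ...   | ≡.refl = ≡.refl
    pair-sur : ∀ x → A x → Σ (Fin k) (λ u → Σ (Fin i) (λ j → pair u j ≈ᴹ x))
    pair-sur x Ax = u , j , ≈ᴹ-trans (+ᴹ-congʳ eu) (Gᴹ.//-rightDividesˡ (lift j) x)
      where
      j = proj₁ (elt-sur #im (f x) (x , Ax , ≈ᴹ-refl))
      f[x-lift]≈0 : f (x +ᴹ -ᴹ lift j) ≈ᴹ 0ᴹ
      f[x-lift]≈0 = ≈ᴹ-trans (f-+ _ _) (≈ᴹ-trans (+ᴹ-congˡ (map-neg f f-cong f-+ (lift j)))
        (Gᴹ.x≈y⇒x∙y⁻¹≈ε (≈ᴹ-sym (≈ᴹ-trans (f-lift j) (proj₂ (elt-sur #im (f x) (x , Ax , ≈ᴹ-refl)))))))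
      u = proj₁ (elt-sur #ker (x +ᴹ -ᴹ lift j) (A-+ Ax (A-neg (lift-A j)) , f[x-lift]≈0))
      eu = proj₂ (elt-sur #ker (x +ᴹ -ᴹ lift j) (A-+ Ax (A-neg (lift-A j)) , f[x-lift]≈0))
    #ker×im : HasCard M A (k *ℕ i)
    #ker×im = record
      { elt = λ t → uncurry pair (remQuot {k} i t)
      ; elt-in = λ t → A-+ (proj₁ (elt-in #ker (proj₁ (remQuot {k} i t)))) (lift-A (proj₂ (remQuot {k} i t)))
      ; elt-inj = λ t t' e → ≡.trans (≡.sym (Fin.combine-remQuot {k} i t))
                    (≡.trans (≡.cong (uncurry combine) (pair-inj _ _ _ _ e)) (Fin.combine-remQuot {k} i t'))
      ; elt-sur = λ x Ax → let u , j , pair≈x = pair-sur x Ax in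
          combine u j , ≈ᴹ-trans (≈ᴹ-reflexive (≡.cong (uncurry pair) (Fin.remQuot-combine u j))) pair≈x }

module OperatorCounting {r ℓr m ℓm} {R : CommutativeRing r ℓr} (M : Module R m ℓm)
                        {N : ℕ} (G : CyclicAction M N) (fin : Finite M) where
  open import Data.Product using (_×_)
  open OperatorCalculus M G
  open FiniteCounting M fin
  open Module M
  import Algebra.Properties.Group +ᴹ-group as Gᴹ

  Ker : Operator → Carrierᴹ → Set ℓm
  Ker A x = ⟦ A ⟧ x ≈ᴹ 0ᴹ

  Im : Operator → Carrierᴹ → Set (m ⊔ ℓm)
  Im A x = Σ Carrierᴹ (λ y → ⟦ A ⟧ y ≈ᴹ x)

  Im-resp : ∀ A → Respects≈ᴹ (Im A)
  Im-resp A x≈x' (y , Ay≈x) = y , ≈ᴹ-trans Ay≈x x≈x'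

  #Ker : ∀ A → Σ ℕ (HasCard M (Ker A))
  #Ker A = count (Ker A) (λ x≈y Ax≈0 → ≈ᴹ-trans (⟦⟧-cong A (≈ᴹ-sym x≈y)) Ax≈0) (λ x → ⟦ A ⟧ x ≟ᴹ 0ᴹ)

  #Im : ∀ A → Σ ℕ (HasCard M (Im A))
  #Im A = count (Im A) (Im-resp A)
    (λ x → ∃? (λ y → ⟦ A ⟧ y ≈ᴹ x) (λ y≈y' Ay≈x → ≈ᴹ-trans (⟦⟧-cong A (≈ᴹ-sym y≈y')) Ay≈x) (λ y → ⟦ A ⟧ y ≟ᴹ x))

  |Ker| |Im| : Operator → ℕ
  |Ker| A = proj₁ (#Ker A)
  |Im|  A = proj₁ (#Im A)

  |M|≡|Ker|*|Im| : ∀ A → proj₁ fin ≡ |Ker| A *ℕ |Im| A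
  |M|≡|Ker|*|Im| A = rank-nullity (λ _ → ⊤) (λ _ _ → tt) (λ _ → tt) ⟦ A ⟧ (⟦⟧-cong A) (⟦⟧-+ A) (proj₂ fin)
    (HasCard-transfer (λ x Ax≈0 → tt , Ax≈0) (λ x → proj₂) (proj₂ (#Ker A)))
    (HasCard-transfer (λ x (y , Ay≈x) → y , tt , Ay≈x) (λ x (y , _ , Ay≈x) → y , Ay≈x) (proj₂ (#Im A)))

  Im⊆Ker : ∀ {P E} → P * E ≈ 0# → ∀ x → Im E x → Ker P x
  Im⊆Ker {P} {E} PE≈0 x (y , Ey≈x) = ≈ᴹ-trans (⟦⟧-cong P (≈ᴹ-sym Ey≈x)) (≈ᴹ-trans (at PE≈0 y) (*ₗ-zeroˡ y))

  -- |M| = |ker P| |im P| = |ker E| |im E| and |im E| = |ker P|, so the inclusion im P ⊆ ker E is an equality.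
  herbrand : ∀ P E → P * E ≈ 0# → (∀ x → Ker P x → Im E x) → ∀ x → Ker E x → Im P x
  herbrand P E PE≈0 KerP⊆ImE = HasCard-⊆⇒⊇ (Im-resp P) (proj₂ (#Im P)) #KerE (Im⊆Ker EP≈0)
    where
    EP≈0 : E * P ≈ 0#
    EP≈0 = pointwise (λ x → ≈ᴹ-trans (⟦⟧-comm E P x) (at PE≈0 x))
    |Im|E≡|Ker|P : |Im| E ≡ |Ker| P
    |Im|E≡|Ker|P = HasCard-unique (proj₂ (#Im E)) (proj₂ (#Ker P)) (Im⊆Ker PE≈0) KerP⊆ImE
    |Im|P≡|Ker|E : |Im| P ≡ |Ker| E
    |Im|P≡|Ker|E = ℕ.*-cancelʳ-≡ (|Im| P) (|Ker| E) (|Ker| P) {{>-nonZero (HasCard-inhabited (proj₂ (#Ker P)) 0ᴹ (⟦⟧-0 P))}}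
      (≡.trans (ℕ.*-comm (|Im| P) _) (≡.trans (≡.sym (|M|≡|Ker|*|Im| P))
        (≡.trans (|M|≡|Ker|*|Im| E) (≡.cong (|Ker| E *ℕ_) |Im|E≡|Ker|P))))
    #KerE : HasCard M (Ker E) (|Im| P)
    #KerE = ≡.subst (HasCard M (Ker E)) (≡.sym |Im|P≡|Ker|E) (proj₂ (#Ker E))

  open import Algebra.Properties.Monoid.Mult +ᴹ-monoid using (×-assocˡ) renaming (_×_ to _×ᴹ_; ×-congʳ to ×ᴹ-congʳ)
  open import Relation.Binary.Reasoning.Setoid ≈ᴹ-setoid

  ⟦⟧-×ᴹ : ∀ A n x → ⟦ A ⟧ (n ×ᴹ x) ≈ᴹ n ×ᴹ ⟦ A ⟧ x
  ⟦⟧-×ᴹ A zero    x = ⟦⟧-0 A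
  ⟦⟧-×ᴹ A (suc n) x = ≈ᴹ-trans (⟦⟧-+ A _ _) (+ᴹ-congˡ (⟦⟧-×ᴹ A n x))

  ×ᴹ-distrib-+ᴹ : ∀ n x y → n ×ᴹ (x +ᴹ y) ≈ᴹ n ×ᴹ x +ᴹ n ×ᴹ y
  ×ᴹ-distrib-+ᴹ zero    x y = ≈ᴹ-sym (+ᴹ-identityʳ 0ᴹ)
  ×ᴹ-distrib-+ᴹ (suc n) x y = ≈ᴹ-trans (+ᴹ-congˡ (×ᴹ-distrib-+ᴹ n x y)) (interchange x y _ _)
    where open import Algebra.Properties.CommutativeSemigroup (AbelianGroup.commutativeSemigroup +ᴹ-abelianGroup) using (interchange)

  sumM-cong : ∀ n {f g} → (∀ i → f i ≈ᴹ g i) → sumM M n f ≈ᴹ sumM M n g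
  sumM-cong zero    f≈g = ≈ᴹ-refl
  sumM-cong (suc n) f≈g = +ᴹ-cong (sumM-cong n f≈g) (f≈g n)

  sumM-const : ∀ n w → sumM M n (λ _ → w) ≈ᴹ n ×ᴹ w
  sumM-const zero    w = ≈ᴹ-refl
  sumM-const (suc n) w = ≈ᴹ-trans (+ᴹ-congʳ (sumM-const n w)) (+ᴹ-comm _ w)

  -- P, E play the roles of σ − ψ(σ) and ε_ψ for G, and P′, E′ those for the subgroup H.
  module NormLifting (P E P′ E′ U W : Operator) (q : ℕ)
      (P′≈PU : P′ ≈ P * U) (E′U≈EW : E′ * U ≈ E * W) (P′E′≈0 : P′ * E′ ≈ 0#)
      (E′-on-KerP : ∀ w → Ker P w → ⟦ E′ ⟧ w ≈ᴹ q ×ᴹ w)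
      (KerP′⊆ImE′ : ∀ x → Ker P′ x → Im E′ x) where

    SplitsWith : ℕ → Carrierᴹ → Set (m ⊔ ℓm)
    SplitsWith c w = Σ Carrierᴹ (λ z → Σ Carrierᴹ (λ w′ → Ker P w′ × w ≈ᴹ ⟦ E ⟧ z +ᴹ c ×ᴹ w′))

    decompose : ∀ w → Ker P w → SplitsWith q w
    decompose w Pw≈0 = ⟦ W ⟧ z , w′ , Pw′≈0 , w≈EWz+qw′
      where
      KerP⊆KerP′ : ∀ x → Ker P x → Ker P′ x
      KerP⊆KerP′ x Px≈0 = ≈ᴹ-trans (at P′≈PU x) (≈ᴹ-trans (⟦⟧-comm P U x) (≈ᴹ-trans (⟦⟧-cong U Px≈0) (⟦⟧-0 U)))
      y = proj₁ (KerP′⊆ImE′ w (KerP⊆KerP′ w Pw≈0))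
      E′y≈w = proj₂ (KerP′⊆ImE′ w (KerP⊆KerP′ w Pw≈0))
      Py∈KerE′ : Ker E′ (⟦ P ⟧ y)
      Py∈KerE′ = ≈ᴹ-trans (⟦⟧-comm E′ P y) (≈ᴹ-trans (⟦⟧-cong P E′y≈w) Pw≈0)
      z = proj₁ (herbrand P′ E′ P′E′≈0 KerP′⊆ImE′ (⟦ P ⟧ y) Py∈KerE′)
      P′z≈Py = proj₂ (herbrand P′ E′ P′E′≈0 KerP′⊆ImE′ (⟦ P ⟧ y) Py∈KerE′)
      w′ = y +ᴹ -ᴹ ⟦ U ⟧ z
      Pw′≈0 : Ker P w′
      Pw′≈0 = ≈ᴹ-trans (⟦⟧-+ P y _) (≈ᴹ-trans (+ᴹ-congˡ (⟦⟧-neg P _))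
        (Gᴹ.x≈y⇒x∙y⁻¹≈ε (≈ᴹ-sym (≈ᴹ-trans (≈ᴹ-sym (at P′≈PU z)) P′z≈Py))))
      w≈EWz+qw′ : w ≈ᴹ ⟦ E ⟧ (⟦ W ⟧ z) +ᴹ q ×ᴹ w′
      w≈EWz+qw′ = begin
        w                                 ≈⟨ E′y≈w ⟨
        ⟦ E′ ⟧ y                          ≈⟨ ⟦⟧-cong E′ (Gᴹ.//-rightDividesˡ (⟦ U ⟧ z) y) ⟨
        ⟦ E′ ⟧ (w′ +ᴹ ⟦ U ⟧ z)            ≈⟨ ≈ᴹ-trans (⟦⟧-+ E′ w′ _) (+ᴹ-comm _ _) ⟩
        ⟦ E′ ⟧ (⟦ U ⟧ z) +ᴹ ⟦ E′ ⟧ w′     ≈⟨ +ᴹ-cong (at E′U≈EW z) (E′-on-KerP w′ Pw′≈0) ⟩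
        ⟦ E ⟧ (⟦ W ⟧ z) +ᴹ q ×ᴹ w′        ∎

    compose : ∀ {a b w} → SplitsWith a w → (∀ w′ → Ker P w′ → SplitsWith b w′) → SplitsWith (a *ℕ b) w
    compose {a} {b} {w} (z , w₁ , Pw₁≈0 , w≈Ez+aw₁) split with z₁ , w₂ , Pw₂≈0 , w₁≈Ez₁+bw₂ ← split w₁ Pw₁≈0 =
      z +ᴹ a ×ᴹ z₁ , w₂ , Pw₂≈0 , (begin
        w                                                ≈⟨ w≈Ez+aw₁ ⟩
        ⟦ E ⟧ z +ᴹ a ×ᴹ w₁                               ≈⟨ +ᴹ-congˡ (≈ᴹ-trans (×ᴹ-congʳ a w₁≈Ez₁+bw₂) (×ᴹ-distrib-+ᴹ a _ _)) ⟩
        ⟦ E ⟧ z +ᴹ (a ×ᴹ ⟦ E ⟧ z₁ +ᴹ a ×ᴹ (b ×ᴹ w₂))     ≈⟨ +ᴹ-assoc _ _ _ ⟨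
        (⟦ E ⟧ z +ᴹ a ×ᴹ ⟦ E ⟧ z₁) +ᴹ a ×ᴹ (b ×ᴹ w₂)
            ≈⟨ +ᴹ-cong (≈ᴹ-trans (+ᴹ-congˡ (≈ᴹ-sym (⟦⟧-×ᴹ E a z₁))) (≈ᴹ-sym (⟦⟧-+ E z _))) (×-assocˡ w₂ a b) ⟩
        ⟦ E ⟧ (z +ᴹ a ×ᴹ z₁) +ᴹ (a *ℕ b) ×ᴹ w₂           ∎)

    iterate : ∀ t w → Ker P w → SplitsWith (q ^ℕ t) w
    iterate zero    w Pw≈0 = 0ᴹ , w , Pw≈0 , ≈ᴹ-sym (≈ᴹ-trans (+ᴹ-cong (⟦⟧-0 E) (+ᴹ-identityʳ w)) (+ᴹ-identityˡ w))
    iterate (suc t) w Pw≈0 = compose {q} {q ^ℕ t} (decompose w Pw≈0) (iterate t)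

    KerP⊆ImE : ∀ n → (∀ w → Ker P w → ⟦ E ⟧ w ≈ᴹ (q ^ℕ n) ×ᴹ w) → ∀ x → Ker P x → Im E x
    KerP⊆ImE n E-on-KerP x Px≈0 with z , w , Pw≈0 , x≈Ez+qⁿw ← iterate n x Px≈0 =
      z +ᴹ w , ≈ᴹ-trans (⟦⟧-+ E z w) (≈ᴹ-trans (+ᴹ-congˡ (E-on-KerP w Pw≈0)) (≈ᴹ-sym x≈Ez+qⁿw))

  module KernelChain (P : ℕ → Operator) (n : ℕ) (∏P≈0 : ∏ n P ≈ 0#)
                     (KerP⊆Im∏ : ∀ j → j < n → ∀ x → Ker (P j) x → Im (∏ j P) x) where

    |Im∏|-step : ∀ j → j < n → |Im| (∏ j P) ≡ |Ker| (P j) *ℕ |Im| (∏ (suc j) P)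
    |Im∏|-step j j<n = rank-nullity (Im Q) Im-+ Im-neg ⟦ P j ⟧ (⟦⟧-cong (P j)) (⟦⟧-+ (P j)) (proj₂ (#Im Q))
      (HasCard-transfer (λ x Px≈0 → KerP⊆Im∏ j j<n x Px≈0 , Px≈0) (λ x → proj₂) (proj₂ (#Ker (P j))))
      (HasCard-transfer
        (λ y (y′ , QPy′≈y) → ⟦ Q ⟧ y′ , (y′ , ≈ᴹ-refl) , ≈ᴹ-trans (⟦⟧-comm (P j) Q y′) QPy′≈y)
        (λ y (x , (y′ , Qy′≈x) , Px≈y) → y′ , ≈ᴹ-trans (⟦⟧-comm Q (P j) y′) (≈ᴹ-trans (⟦⟧-cong (P j) Qy′≈x) Px≈y))
        (proj₂ (#Im (∏ (suc j) P))))
      where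
      Q = ∏ j P
      Im-+ : ∀ {x y} → Im Q x → Im Q y → Im Q (x +ᴹ y)
      Im-+ (y₁ , Qy₁≈x) (y₂ , Qy₂≈y) = y₁ +ᴹ y₂ , ≈ᴹ-trans (⟦⟧-+ Q y₁ y₂) (+ᴹ-cong Qy₁≈x Qy₂≈y)
      Im-neg : ∀ {x} → Im Q x → Im Q (-ᴹ x)
      Im-neg (y , Qy≈x) = -ᴹ y , ≈ᴹ-trans (⟦⟧-neg Q y) (-ᴹ‿cong Qy≈x)

    |Im∏|≡∏|Ker| : ∀ r j → j +ℕ r ≡ n → |Im| (∏ j P) ≡ prodFin r (λ i → |Ker| (P (j +ℕ toℕ i)))
    |Im∏|≡∏|Ker| zero j j+0≡n = HasCard-unique (proj₂ (#Im (∏ j P))) HasCard-zero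
      (λ x (y , ∏Py≈x) → ≈ᴹ-trans (≈ᴹ-sym ∏Py≈x) (≈ᴹ-trans (at ∏jP≈0 y) (*ₗ-zeroˡ y)))
      (λ x x≈0 → 0ᴹ , ≈ᴹ-trans (⟦⟧-0 (∏ j P)) (≈ᴹ-sym x≈0))
      where
      ∏jP≈0 : ∏ j P ≈ 0#
      ∏jP≈0 = ≡.subst (λ t → ∏ t P ≈ 0#) (≡.trans (≡.sym j+0≡n) (ℕ.+-identityʳ j)) ∏P≈0
    |Im∏|≡∏|Ker| (suc r) j j+r+1≡n = ≡.trans (|Im∏|-step j j<n)
      (≡.cong₂ _*ℕ_ (≡.cong (λ t → |Ker| (P t)) (≡.sym (ℕ.+-identityʳ j)))
        (≡.trans (|Im∏|≡∏|Ker| r (suc j) (≡.trans (≡.sym (ℕ.+-suc j r)) j+r+1≡n))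
                 (prodFin-cong r (λ i → ≡.cong (λ t → |Ker| (P t)) (≡.sym (ℕ.+-suc j (toℕ i)))))))
      where
      j<n : j < n
      j<n = ≡.subst (j <_) j+r+1≡n (ℕ.m<m+n j (s≤s z≤n))

    |M|≡∏|Ker| : proj₁ fin ≡ prodFin n (λ i → |Ker| (P (toℕ i)))
    |M|≡∏|Ker| = ≡.trans (HasCard-unique (proj₂ fin) (proj₂ (#Im 1#)) (λ x _ → x , *ₗ-identityˡ x) (λ _ _ → tt))
                         (|Im∏|≡∏|Ker| n 0 ≡.refl)

-- Characters of G and of its subgroup of order p

module CyclotomicOperators {r ℓr m ℓm} (p'' k : ℕ) (p-prime : Prime (suc (suc p'')))
    {R : CommutativeRing r ℓr} (φ : CyclotomicHom R (suc (suc p'')) (suc k)) {M : Module R m ℓm}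
    (G : CyclicAction M (suc (suc p'') ^ℕ suc k)) where

  p N L : ℕ
  p = suc (suc p'')
  N = p ^ℕ suc k
  L = p ^ℕ k

  open OperatorCalculus M G using (Operator; scalar; σ̂; operatorRing; scalar-cong; scalar-powR; scalar-sumR; σ̂^N≈1)
  open CommutativeRing operatorRing
  open import Relation.Binary.Reasoning.Setoid setoid
  open import Algebra.Solver.Ring.NaturalCoefficients.Default commutativeSemiring
  open import Algebra.Properties.CommutativeSemiring.Exp commutativeSemiring
  open import Algebra.Properties.Ring ring using (-‿distribʳ-*)
  open FiniteSumsAndProducts operatorRing
  open GeometricSums operatorRing
  open PrimePowerCyclotomic operatorRing (suc p'') p-prime using (p^-pred; suc-p^-pred; cyclotomic-∏; ∏-all-roots)
  open PrimeCyclotomic operatorRing using (ω^p≈1; ω^-mod)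

  ζ̂ : Operator
  ζ̂ = scalar (CyclotomicHom.ζ φ)

  Φζ̂≈0 : ∑[ i < p ] ζ̂ ^ (i *ℕ L) ≈ 0#
  Φζ̂≈0 = begin
    ∑[ i < p ] ζ̂ ^ (i *ℕ L)                         ≈⟨ ∑-cong p (λ i → scalar-powR _ (i *ℕ L)) ⟨
    ∑[ i < p ] scalar (powR R (CyclotomicHom.ζ φ) (i *ℕ L)) ≈⟨ scalar-sumR p _ ⟨
    scalar (cyclotomicAt R p (suc k) (CyclotomicHom.ζ φ)) ≈⟨ scalar-cong (CyclotomicHom.isRoot φ) ⟩
    scalar (CommutativeRing.0# R)                   ∎

  ω : Operator
  ω = ζ̂ ^ L

  Φω≈0 : ∑[ i < p ] ω ^ i ≈ 0#
  Φω≈0 = trans (∑-cong p (λ i → trans (^-assocʳ ζ̂ L i) (^-congʳ ζ̂ (ℕ.*-comm L i)))) Φζ̂≈0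

  ζ̂^N≈1 : ζ̂ ^ N ≈ 1#
  ζ̂^N≈1 = trans (^-congʳ ζ̂ (ℕ.*-comm p L)) (trans (sym (^-assocʳ ζ̂ L p)) (ω^p≈1 (suc p'') p-prime ω Φω≈0))

  1<N : 1 < N
  1<N = ≡.subst (1 <_) (suc-p^-pred k) (1<suc-p^-pred k)
    where
    1<suc-p^-pred : ∀ k → 1 < suc (p^-pred k)
    1<suc-p^-pred zero    = s≤s (s≤s z≤n)
    1<suc-p^-pred (suc k) = s≤s (s≤s z≤n)

  1≤N : 1 ≤ N
  1≤N = ℕ.<⇒≤ 1<N

  ζ̂^-+N : ∀ a → ζ̂ ^ (a +ℕ N) ≈ ζ̂ ^ a
  ζ̂^-+N a = trans (^-homo-* ζ̂ a N) (trans (*-congˡ ζ̂^N≈1) (*-identityʳ _))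

  P : ℕ → Operator
  P j = σ̂ - ζ̂ ^ j

  ∏P≈0 : ∏ N P ≈ 0#
  ∏P≈0 = begin
    ∏[ i < N ] (σ̂ - ζ̂ ^ i)              ≈⟨ ∏-cong N (λ i → +-congˡ (-‿cong (*-identityˡ _))) ⟨
    ∏[ i < N ] (σ̂ - 1# * ζ̂ ^ i)         ≡⟨ ≡.cong (λ n → ∏[ i < n ] (σ̂ - 1# * ζ̂ ^ i)) (≡.sym (suc-p^-pred k)) ⟩
    ∏[ i < suc (p^-pred k) ] (σ̂ - 1# * ζ̂ ^ i)  ≈⟨ ∏-all-roots {p^-pred k} (cyclotomic-∏ k ζ̂ Φζ̂≈0) σ̂ 1# ⟩
    σ̂ ^ suc (p^-pred k) - 1# ^ suc (p^-pred k) ≡⟨ ≡.cong (λ n → σ̂ ^ n - 1# ^ n) (suc-p^-pred k) ⟩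
    σ̂ ^ N - 1# ^ N                       ≈⟨ +-cong σ̂^N≈1 (-‿cong (1^n≈1 N)) ⟩
    1# - 1#                              ≈⟨ -‿inverseʳ 1# ⟩
    0#                                   ∎

  module Twist (j : ℕ) where
    -- c = ψ(σ)⁻¹ in the form used by `epsilon`, and Z = ψ(σ)⁻¹ σ.
    d c Z : Operator
    d = ζ̂ ^ j
    c = ζ̂ ^ (j *ℕ (N ∸ 1))
    Z = c * σ̂

    c*d≈1 : c * d ≈ 1#
    c*d≈1 = begin
      ζ̂ ^ (j *ℕ (N ∸ 1)) * ζ̂ ^ j    ≈⟨ ^-homo-* ζ̂ (j *ℕ (N ∸ 1)) j ⟨
      ζ̂ ^ (j *ℕ (N ∸ 1) +ℕ j)       ≡⟨ ≡.cong (ζ̂ ^_) (j*[N∸1]+j≡N*j j N 1≤N) ⟩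
      ζ̂ ^ (N *ℕ j)                  ≈⟨ ^-assocʳ ζ̂ N j ⟨
      (ζ̂ ^ N) ^ j                   ≈⟨ trans (^-congˡ j ζ̂^N≈1) (1^n≈1 j) ⟩
      1#                            ∎

    σ̂≈d*Z : σ̂ ≈ d * Z
    σ̂≈d*Z = sym (begin
      d * (c * σ̂)      ≈⟨ *-assoc d c σ̂ ⟨
      (d * c) * σ̂      ≈⟨ *-congʳ (trans (*-comm d c) c*d≈1) ⟩
      1# * σ̂           ≈⟨ *-identityˡ σ̂ ⟩
      σ̂                ∎)

    Z^N≈1 : Z ^ N ≈ 1#
    Z^N≈1 = begin
      (c * σ̂) ^ N                           ≈⟨ ^-distrib-* c σ̂ N ⟩
      c ^ N * σ̂ ^ N                         ≈⟨ *-cong c^N≈1 σ̂^N≈1 ⟩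
      1# * 1#                               ≈⟨ *-identityˡ 1# ⟩
      1#                                    ∎
      where
      c^N≈1 : c ^ N ≈ 1#
      c^N≈1 = trans (^-assocʳ ζ̂ e N) (trans (^-congʳ ζ̂ (ℕ.*-comm e N))
                (trans (sym (^-assocʳ ζ̂ N e)) (trans (^-congˡ e ζ̂^N≈1) (1^n≈1 e))))
        where e = j *ℕ (N ∸ 1)

    d^L≈ζ̂^[L*[j%p]] : d ^ L ≈ ζ̂ ^ (L *ℕ (j % p))
    d^L≈ζ̂^[L*[j%p]] = begin
      (ζ̂ ^ j) ^ L          ≈⟨ ^-assocʳ ζ̂ j L ⟩
      ζ̂ ^ (j *ℕ L)         ≡⟨ ≡.cong (ζ̂ ^_) (ℕ.*-comm j L) ⟩
      ζ̂ ^ (L *ℕ j)         ≈⟨ ^-assocʳ ζ̂ L j ⟨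
      ω ^ j                ≈⟨ ω^-mod (suc p'') p-prime ω Φω≈0 j ⟩
      ω ^ (j % p)          ≈⟨ ^-assocʳ ζ̂ L (j % p) ⟩
      ζ̂ ^ (L *ℕ (j % p))   ∎

    c^L≈[d^L]^[N∸1] : c ^ L ≈ (d ^ L) ^ (N ∸ 1)
    c^L≈[d^L]^[N∸1] = begin
      (ζ̂ ^ (j *ℕ (N ∸ 1))) ^ L    ≈⟨ ^-assocʳ ζ̂ (j *ℕ (N ∸ 1)) L ⟩
      ζ̂ ^ (j *ℕ (N ∸ 1) *ℕ L)     ≡⟨ ≡.cong (ζ̂ ^_) (ℕ*.xy∙z≈xz∙y j (N ∸ 1) L) ⟩
      ζ̂ ^ (j *ℕ L *ℕ (N ∸ 1))     ≈⟨ ^-assocʳ ζ̂ (j *ℕ L) (N ∸ 1) ⟨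
      (ζ̂ ^ (j *ℕ L)) ^ (N ∸ 1)    ≈⟨ ^-congˡ (N ∸ 1) (^-assocʳ ζ̂ j L) ⟨
      (d ^ L) ^ (N ∸ 1)           ∎

    Z^t≈ : ∀ t → Z ^ t ≈ ζ̂ ^ (j *ℕ t *ℕ (N ∸ 1)) * σ̂ ^ t
    Z^t≈ t = begin
      (c * σ̂) ^ t                       ≈⟨ ^-distrib-* c σ̂ t ⟩
      c ^ t * σ̂ ^ t                     ≈⟨ *-congʳ (^-assocʳ ζ̂ (j *ℕ (N ∸ 1)) t) ⟩
      ζ̂ ^ (j *ℕ (N ∸ 1) *ℕ t) * σ̂ ^ t   ≡⟨ ≡.cong (λ e → ζ̂ ^ e * σ̂ ^ t) (ℕ*.xy∙z≈xz∙y j (N ∸ 1) t) ⟩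
      ζ̂ ^ (j *ℕ t *ℕ (N ∸ 1)) * σ̂ ^ t   ∎

    [d^L]^t≈ : ∀ t → (d ^ L) ^ t ≈ ζ̂ ^ (L *ℕ (j % p) *ℕ t)
    [d^L]^t≈ t = trans (^-congˡ t d^L≈ζ̂^[L*[j%p]]) (^-assocʳ ζ̂ (L *ℕ (j % p)) t)

    [Z^L]^t≈ : ∀ t → (Z ^ L) ^ t ≈ ζ̂ ^ (L *ℕ (j % p) *ℕ t *ℕ (N ∸ 1)) * σ̂ ^ (L *ℕ t)
    [Z^L]^t≈ t = begin
      ((c * σ̂) ^ L) ^ t                                 ≈⟨ ^-congˡ t (^-distrib-* c σ̂ L) ⟩
      (c ^ L * σ̂ ^ L) ^ t                               ≈⟨ ^-distrib-* (c ^ L) (σ̂ ^ L) t ⟩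
      (c ^ L) ^ t * (σ̂ ^ L) ^ t                         ≈⟨ *-cong (^-congˡ t c^L≈[d^L]^[N∸1]) (^-assocʳ σ̂ L t) ⟩
      ((d ^ L) ^ (N ∸ 1)) ^ t * σ̂ ^ (L *ℕ t)            ≈⟨ *-congʳ (^-congˡ t (^-congˡ (N ∸ 1) d^L≈ζ̂^[L*[j%p]])) ⟩
      ((ζ̂ ^ (L *ℕ (j % p))) ^ (N ∸ 1)) ^ t * σ̂ ^ (L *ℕ t)
                                                        ≈⟨ *-congʳ (trans (^-assocʳ (ζ̂ ^ (L *ℕ (j % p))) (N ∸ 1) t) (^-assocʳ ζ̂ (L *ℕ (j % p)) ((N ∸ 1) *ℕ t))) ⟩
      ζ̂ ^ (L *ℕ (j % p) *ℕ ((N ∸ 1) *ℕ t)) * σ̂ ^ (L *ℕ t)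
                                                        ≡⟨ ≡.cong (λ e → ζ̂ ^ e * σ̂ ^ (L *ℕ t)) (ℕ*.x∙yz≈xz∙y (L *ℕ (j % p)) (N ∸ 1) t) ⟩
      ζ̂ ^ (L *ℕ (j % p) *ℕ t *ℕ (N ∸ 1)) * σ̂ ^ (L *ℕ t) ∎

    E P′ E′ U W : Operator
    E  = ∑[ t < N ] Z ^ t
    P′ = σ̂ ^ L - d ^ L
    E′ = ∑[ t < p ] (Z ^ L) ^ t
    U  = geom L σ̂ d
    W  = c * d ^ L

    geom-annihilated : ∀ a b → a *ℕ b ≡ N → (σ̂ ^ a - d ^ a) * geom b (Z ^ a) 1# ≈ 0#
    geom-annihilated a b a*b≡N = begin
      (σ̂ ^ a - d ^ a) * geom b (Z ^ a) 1#          ≈⟨ *-congʳ (+-cong (trans (^-congˡ a σ̂≈d*Z) (^-distrib-* d Z a))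
                                                                      (-‿cong (sym (*-identityʳ _)))) ⟩
      (d ^ a * Z ^ a - d ^ a * 1#) * geom b (Z ^ a) 1#
                                                    ≈⟨ *-congʳ (+-congˡ (-‿distribʳ-* (d ^ a) 1#)) ⟩
      (d ^ a * Z ^ a + d ^ a * (- 1#)) * geom b (Z ^ a) 1#
        ≈⟨ solve 4 (λ x z n g → (x :* z :+ x :* n) :* g := x :* ((z :+ n) :* g)) refl (d ^ a) (Z ^ a) (- 1#) _ ⟩
      d ^ a * ((Z ^ a - 1#) * geom b (Z ^ a) 1#)   ≈⟨ *-congˡ (geom-telescope b (Z ^ a) 1#) ⟩
      d ^ a * ((Z ^ a) ^ b - 1# ^ b)               ≈⟨ *-congˡ (+-cong (trans (^-assocʳ Z a b) (trans (^-congʳ Z a*b≡N) Z^N≈1))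
                                                                      (-‿cong (1^n≈1 b))) ⟩
      d ^ a * (1# - 1#)                            ≈⟨ trans (*-congˡ (-‿inverseʳ 1#)) (zeroʳ _) ⟩
      0#                                           ∎

    P*E≈0 : P j * E ≈ 0#
    P*E≈0 = begin
      (σ̂ - ζ̂ ^ j) * E                      ≈⟨ *-cong (+-cong (sym (*-identityʳ σ̂)) (-‿cong (sym (*-identityʳ d))))
                                                      (trans (sym (geom-1ʳ N Z)) (geom-cong N (sym (*-identityʳ Z)) refl)) ⟩
      (σ̂ ^ 1 - d ^ 1) * geom N (Z ^ 1) 1#  ≈⟨ geom-annihilated 1 N (ℕ.*-identityˡ N) ⟩
      0#                                   ∎

    P′*E′≈0 : P′ * E′ ≈ 0#
    P′*E′≈0 = trans (*-congˡ (sym (geom-1ʳ p (Z ^ L)))) (geom-annihilated L p (ℕ.*-comm L p))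

    P′≈P*U : P′ ≈ P j * U
    P′≈P*U = sym (geom-telescope L σ̂ d)

    E′*U≈E*W : E′ * U ≈ E * W
    E′*U≈E*W = begin
      E′ * U                                         ≈⟨ *-cong (sym (geom-1ʳ p (Z ^ L))) U≈W*geom ⟩
      geom p (Z ^ L) 1# * (W * geom L Z 1#)          ≈⟨ solve 3 (λ e w g → e :* (w :* g) := (g :* e) :* w) refl _ W _ ⟩
      (geom L Z 1# * geom p (Z ^ L) 1#) * W          ≈⟨ *-congʳ (sym E≈geom*geom) ⟩
      E * W                                          ∎
      where
      U≈W*geom : U ≈ W * geom L Z 1#
      U≈W*geom = begin
        geom L σ̂ d                               ≈⟨ geom-cong L σ̂≈d*Z (sym (*-identityʳ d)) ⟩
        geom L (d * Z) (d * 1#)                  ≈⟨ *-identityˡ _ ⟨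
        1# * geom L (d * Z) (d * 1#)             ≈⟨ *-congʳ c*d≈1 ⟨
        (c * d) * geom L (d * Z) (d * 1#)        ≈⟨ *-assoc c d _ ⟩
        c * (d * geom L (d * Z) (d * 1#))        ≈⟨ *-congˡ (geom-homogeneous L d Z 1#) ⟩
        c * (d ^ L * geom L Z 1#)                ≈⟨ *-assoc c _ _ ⟨
        W * geom L Z 1#                          ∎
      E≈geom*geom : E ≈ geom L Z 1# * geom p (Z ^ L) 1#
      E≈geom*geom = begin
        E                                        ≈⟨ geom-1ʳ N Z ⟨
        geom N Z 1#                              ≡⟨ ≡.cong (λ n → geom n Z 1#) (ℕ.*-comm p L) ⟩
        geom (L *ℕ p) Z 1#                       ≈⟨ geom-* L p Z 1# ⟩
        geom L Z 1# * geom p (Z ^ L) (1# ^ L)    ≈⟨ *-congˡ (geom-cong p refl (1^n≈1 L)) ⟩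
        geom L Z 1# * geom p (Z ^ L) 1#          ∎

    E-factors : j < N → Σ Operator (λ V → E ≈ ∏ j P * V)
    E-factors j<N = c ^ L' * (∏[ i < R₁ ] P (j +ℕ suc i)) , (begin
      E                                               ≈⟨ geom-1ʳ N Z ⟨
      geom N Z 1#                                     ≡⟨ ≡.cong (λ n → geom n Z 1#) (≡.sym (suc-p^-pred k)) ⟩
      geom (suc L') Z 1#                              ≈⟨ cyclotomic-∏ k ζ̂ Φζ̂≈0 Z 1# ⟨
      ∏[ i < L' ] (Z - 1# * ζ̂ ^ suc i)                ≈⟨ ∏-cong L' twisted-factor ⟩
      ∏[ i < L' ] (c * P (j +ℕ suc i))                ≈⟨ ∏-distrib L' (λ _ → c) _ ⟩
      (∏[ _ < L' ] c) * (∏[ i < L' ] P (j +ℕ suc i))  ≈⟨ *-cong (∏-const L' c) split ⟩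
      c ^ L' * ((∏[ i < R₁ ] P (j +ℕ suc i)) * ∏ j P)
        ≈⟨ solve 3 (λ a b q → a :* (b :* q) := q :* (a :* b)) refl (c ^ L') _ (∏ j P) ⟩
      ∏ j P * (c ^ L' * (∏[ i < R₁ ] P (j +ℕ suc i)))    ∎)
      where
      L' R₁ : ℕ
      L' = p^-pred k
      R₁ = L' ∸ j
      R₁+j≡L' : R₁ +ℕ j ≡ L'
      R₁+j≡L' = ℕ.m∸n+n≡m (ℕ.≤-pred (≡.subst (suc j ≤_) (≡.sym (suc-p^-pred k)) j<N))
      twisted-factor : ∀ i → Z - 1# * ζ̂ ^ suc i ≈ c * P (j +ℕ suc i)
      twisted-factor i = sym (begin
        c * (σ̂ - ζ̂ ^ (j +ℕ suc i))                 ≈⟨ *-congˡ (+-congˡ (-‿cong (^-homo-* ζ̂ j (suc i)))) ⟩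
        c * (σ̂ - d * ζ̂ ^ suc i)                    ≈⟨ trans (distribˡ c σ̂ _) (+-congˡ (sym (-‿distribʳ-* c _))) ⟩
        c * σ̂ - c * (d * ζ̂ ^ suc i)                ≈⟨ +-congˡ (-‿cong (trans (sym (*-assoc c d _)) (*-congʳ c*d≈1))) ⟩
        Z - 1# * ζ̂ ^ suc i                         ∎)
      wrap : ∀ i → P (j +ℕ suc (R₁ +ℕ i)) ≈ P i
      wrap i = +-congˡ (-‿cong (trans (^-congʳ ζ̂ j+suc[R₁+i]≡i+N) (ζ̂^-+N i)))
        where
        j+suc[R₁+i]≡i+N : j +ℕ suc (R₁ +ℕ i) ≡ i +ℕ N
        j+suc[R₁+i]≡i+N = ≡.trans (j+suc[r+i]≡i+suc[r+j] j R₁ i)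
          (≡.cong (i +ℕ_) (≡.trans (≡.cong suc R₁+j≡L') (suc-p^-pred k)))
      split : ∏[ i < L' ] P (j +ℕ suc i) ≈ (∏[ i < R₁ ] P (j +ℕ suc i)) * ∏ j P
      split = begin
        ∏[ i < L' ] P (j +ℕ suc i)                      ≡⟨ ≡.cong (λ n → ∏[ i < n ] P (j +ℕ suc i)) (≡.sym R₁+j≡L') ⟩
        ∏[ i < R₁ +ℕ j ] P (j +ℕ suc i)                 ≈⟨ ∏-split R₁ j _ ⟩
        (∏[ i < R₁ ] P (j +ℕ suc i)) * (∏[ i < j ] P (j +ℕ suc (R₁ +ℕ i)))  ≈⟨ *-congˡ (∏-cong j wrap) ⟩
        (∏[ i < R₁ ] P (j +ℕ suc i)) * ∏ j P            ∎

module TwistedCharacters {r ℓr m ℓm} (p'' k : ℕ) (p-prime : Prime (suc (suc p'')))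
    {R : CommutativeRing r ℓr} (φ : CyclotomicHom R (suc (suc p'')) (suc k)) {M : Module R m ℓm}
    (G : CyclicAction M (suc (suc p'') ^ℕ suc k)) (fin : Finite M)
    (hyp : ∀ (j : Fin (suc (suc p''))) → H0vanishes M G (CyclotomicHom.ζ φ) (suc (suc p'') ^ℕ k) (suc (suc p''))
             (suc (suc p'') ^ℕ k *ℕ toℕ j)) where
  open CyclotomicOperators p'' k p-prime φ G
  open OperatorCalculus M G using (σ̂; ∏; ⟦_⟧; ⟦⟧-cong; at; ⟦σ̂^⟧; ⟦∑⟧; ⟦^⟧-agree; ⟦^⟧-fixes; scalar-powR)
  open OperatorCounting M G fin
  open CommutativeRing (OperatorCalculus.operatorRing M G) using (_*_)
  open import Algebra.Properties.CommutativeSemiring.Exp (CommutativeRing.commutativeSemiring (OperatorCalculus.operatorRing M G))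
    using (_^_; ^-assocʳ)
  open Module M
  open CyclicAction G using (σ)
  import Algebra.Properties.Group +ᴹ-group as Gᴹ
  open import Algebra.Properties.Monoid.Mult +ᴹ-monoid using () renaming (_×_ to _×ᴹ_)

  ζ : CommutativeRing.Carrier R
  ζ = CyclotomicHom.ζ φ

  ⟦ζ̂^*σ̂^⟧ : ∀ a b x → ⟦ ζ̂ ^ a * σ̂ ^ b ⟧ x ≈ᴹ powR R ζ a *ₗ iter M σ b x
  ⟦ζ̂^*σ̂^⟧ a b x = ≈ᴹ-trans (≈ᴹ-sym (at (scalar-powR ζ a) (⟦ σ̂ ^ b ⟧ x))) (*ₗ-cong (CommutativeRing.refl R) (⟦σ̂^⟧ b x))

  ⟦ζ̂^⟧ : ∀ a x → ⟦ ζ̂ ^ a ⟧ x ≈ᴹ powR R ζ a *ₗ x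
  ⟦ζ̂^⟧ a x = ≈ᴹ-sym (at (scalar-powR ζ a) x)

  iter-1* : ∀ t x → iter M σ (1 *ℕ t) x ≈ᴹ iter M σ t x
  iter-1* t x = ≈ᴹ-reflexive (≡.cong (λ n → iter M σ n x) (ℕ.*-identityˡ t))

  module Character (j : ℕ) where
    open Twist j

    Ker⇒σ≈d : ∀ {x} → Ker (P j) x → σ x ≈ᴹ ⟦ d ⟧ x
    Ker⇒σ≈d {x} Px≈0 = Gᴹ.x∙y⁻¹≈ε⇒x≈y _ _ Px≈0

    Ker⇒eigen : ∀ x → Ker (P j) x → eigen M G ζ 1 N j x
    Ker⇒eigen x Px≈0 t = begin
      iter M σ (1 *ℕ toℕ t) x     ≈⟨ iter-1* (toℕ t) x ⟩
      iter M σ (toℕ t) x          ≈⟨ ⟦σ̂^⟧ (toℕ t) x ⟨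
      ⟦ σ̂ ^ toℕ t ⟧ x             ≈⟨ ⟦^⟧-agree σ̂ d x (Ker⇒σ≈d Px≈0) (toℕ t) ⟩
      ⟦ d ^ toℕ t ⟧ x             ≈⟨ at (^-assocʳ ζ̂ j (toℕ t)) x ⟩
      ⟦ ζ̂ ^ (j *ℕ toℕ t) ⟧ x      ≈⟨ ⟦ζ̂^⟧ (j *ℕ toℕ t) x ⟩
      powR R ζ (j *ℕ toℕ t) *ₗ x  ∎
      where open import Relation.Binary.Reasoning.Setoid ≈ᴹ-setoid

    eigen⇒Ker : ∀ x → eigen M G ζ 1 N j x → Ker (P j) x
    eigen⇒Ker x x∈Mψ = Gᴹ.x≈y⇒x∙y⁻¹≈ε (begin
      σ x                         ≈⟨ ≡.subst (λ t → iter M σ (1 *ℕ t) x ≈ᴹ powR R ζ (j *ℕ t) *ₗ x)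
                                            (Fin.toℕ-fromℕ< 1<N) (x∈Mψ (fromℕ< 1<N)) ⟩
      powR R ζ (j *ℕ 1) *ₗ x      ≡⟨ ≡.cong (λ e → powR R ζ e *ₗ x) (ℕ.*-identityʳ j) ⟩
      powR R ζ j *ₗ x             ≈⟨ ⟦ζ̂^⟧ j x ⟨
      ⟦ d ⟧ x                     ∎)
      where open import Relation.Binary.Reasoning.Setoid ≈ᴹ-setoid

    ⟦E⟧≈ε : ∀ y → ⟦ E ⟧ y ≈ᴹ epsilon M G ζ 1 N j y
    ⟦E⟧≈ε y = ≈ᴹ-trans (⟦∑⟧ N (Z ^_) y) (sumM-cong N (λ t →
      ≈ᴹ-trans (at (Z^t≈ t) y) (≈ᴹ-trans (⟦ζ̂^*σ̂^⟧ (j *ℕ t *ℕ (N ∸ 1)) t y) (*ₗ-cong (CommutativeRing.refl R) (≈ᴹ-sym (iter-1* t y))))))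

    Im⇒εImage : ∀ x → Im E x → epsImage M G ζ 1 N j x
    Im⇒εImage x (y , Ey≈x) = y , ≈ᴹ-trans (≈ᴹ-sym (⟦E⟧≈ε y)) Ey≈x

    εImage⇒Im : ∀ x → epsImage M G ζ 1 N j x → Im E x
    εImage⇒Im x (y , εy≈x) = y , ≈ᴹ-trans (⟦E⟧≈ε y) εy≈x

    Z-fixes : ∀ w → Ker (P j) w → ⟦ Z ⟧ w ≈ᴹ w
    Z-fixes w Pw≈0 = ≈ᴹ-trans (⟦⟧-cong c (Ker⇒σ≈d Pw≈0)) (≈ᴹ-trans (at c*d≈1 w) (*ₗ-identityˡ w))

    E-on-Ker : ∀ w → Ker (P j) w → ⟦ E ⟧ w ≈ᴹ N ×ᴹ w
    E-on-Ker w Pw≈0 = ≈ᴹ-trans (⟦∑⟧ N (Z ^_) w) (≈ᴹ-trans (sumM-cong N (⟦^⟧-fixes Z w (Z-fixes w Pw≈0))) (sumM-const N w))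

    E′-on-Ker : ∀ w → Ker (P j) w → ⟦ E′ ⟧ w ≈ᴹ p ×ᴹ w
    E′-on-Ker w Pw≈0 = ≈ᴹ-trans (⟦∑⟧ p ((Z ^ L) ^_) w)
      (≈ᴹ-trans (sumM-cong p (⟦^⟧-fixes (Z ^ L) w (⟦^⟧-fixes Z w (Z-fixes w Pw≈0) L))) (sumM-const p w))

    KerP′⊆ImE′ : ∀ x → Ker P′ x → Im E′ x
    KerP′⊆ImE′ x P′x≈0 = y , ≈ᴹ-trans (⟦E′⟧≈ε y) εy≈x
      where
      open import Relation.Binary.Reasoning.Setoid ≈ᴹ-setoid
      hyp-j : H0vanishes M G ζ L p (L *ℕ (j % p))
      hyp-j = ≡.subst (λ c → H0vanishes M G ζ L p (L *ℕ c)) (Fin.toℕ-fromℕ< (m%n<n j p)) (hyp (fromℕ< (m%n<n j p)))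
      x∈Mχ : eigen M G ζ L p (L *ℕ (j % p)) x
      x∈Mχ t = begin
        iter M σ (L *ℕ toℕ t) x               ≈⟨ ⟦σ̂^⟧ (L *ℕ toℕ t) x ⟨
        ⟦ σ̂ ^ (L *ℕ toℕ t) ⟧ x                ≈⟨ at (^-assocʳ σ̂ L (toℕ t)) x ⟨
        ⟦ (σ̂ ^ L) ^ toℕ t ⟧ x                 ≈⟨ ⟦^⟧-agree (σ̂ ^ L) (d ^ L) x (Gᴹ.x∙y⁻¹≈ε⇒x≈y (⟦ σ̂ ^ L ⟧ x) (⟦ d ^ L ⟧ x) P′x≈0) (toℕ t) ⟩
        ⟦ (d ^ L) ^ toℕ t ⟧ x                 ≈⟨ at ([d^L]^t≈ (toℕ t)) x ⟩
        ⟦ ζ̂ ^ (L *ℕ (j % p) *ℕ toℕ t) ⟧ x     ≈⟨ ⟦ζ̂^⟧ (L *ℕ (j % p) *ℕ toℕ t) x ⟩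
        powR R ζ (L *ℕ (j % p) *ℕ toℕ t) *ₗ x ∎
      y = proj₁ (hyp-j x x∈Mχ)
      εy≈x = proj₂ (hyp-j x x∈Mχ)
      ⟦E′⟧≈ε : ∀ y → ⟦ E′ ⟧ y ≈ᴹ epsilon M G ζ L p (L *ℕ (j % p)) y
      ⟦E′⟧≈ε y = ≈ᴹ-trans (⟦∑⟧ p ((Z ^ L) ^_) y) (sumM-cong p (λ t →
        ≈ᴹ-trans (at ([Z^L]^t≈ t) y) (⟦ζ̂^*σ̂^⟧ (L *ℕ (j % p) *ℕ t *ℕ (N ∸ 1)) (L *ℕ t) y)))

    KerP⊆ImE : ∀ x → Ker (P j) x → Im E x
    KerP⊆ImE = NormLifting.KerP⊆ImE (P j) E P′ E′ U W p P′≈P*U E′*U≈E*W P′*E′≈0 E′-on-Ker KerP′⊆ImE′ (suc k) E-on-Ker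

  KerP⊆Im∏ : ∀ j → j < N → ∀ x → Ker (P j) x → Im (∏ j P) x
  KerP⊆Im∏ j j<N x Px≈0 = ⟦ V ⟧ y , ≈ᴹ-trans (≈ᴹ-sym (at E≈∏*V y)) Ey≈x
    where
    open Twist j using (E; E-factors)
    y = proj₁ (Character.KerP⊆ImE j x Px≈0)
    Ey≈x = proj₂ (Character.KerP⊆ImE j x Px≈0)
    V = proj₁ (E-factors j<N)
    E≈∏*V = proj₂ (E-factors j<N)

  Ĥ⁰-vanishes : ∀ (j : Fin N) → H0vanishes M G ζ 1 N (toℕ j)
  Ĥ⁰-vanishes j x x∈Mψ = Im⇒εImage x (KerP⊆ImE x (eigen⇒Ker x x∈Mψ))
    where open Character (toℕ j)

  |M^ψ| : Fin N → ℕ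
  |M^ψ| j = |Ker| (P (toℕ j))

  |M|≡∏|M^ψ| : proj₁ fin ≡ prodFin N |M^ψ|
  |M|≡∏|M^ψ| = KernelChain.|M|≡∏|Ker| P N ∏P≈0 KerP⊆Im∏

  open FiniteCounting M fin using (HasCard-transfer)

  #eigen : ∀ (j : Fin N) → HasCard M (eigen M G ζ 1 N (toℕ j)) (|M^ψ| j)
  #eigen j = HasCard-transfer (Character.Ker⇒eigen (toℕ j)) (Character.eigen⇒Ker (toℕ j)) (proj₂ (#Ker (P (toℕ j))))

  #εImage : ∀ (j : Fin N) → HasCard M (epsImage M G ζ 1 N (toℕ j)) (|M^ψ| j)
  #εImage j = HasCard-transfer (λ x Px≈0 → Im⇒εImage x (KerP⊆ImE x Px≈0)) (λ x x∈εM → Im⊆Ker P*E≈0 x (εImage⇒Im x x∈εM))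
    (proj₂ (#Ker (P (toℕ j))))
    where open Character (toℕ j)
          open Twist (toℕ j) using (P*E≈0)

open import Data.Nat using (_^_)
open import Data.Product using (_×_)

theorem4p10 : ∀ {r ℓr m ℓm} (p n : ℕ) → Prime p → 1 ≤ n →
    (R : CommutativeRing r ℓr) (φ : CyclotomicHom R p n) (M : Module R m ℓm) →
    (G : CyclicAction M (p ^ n)) → (fin : Finite M) →
    (∀ (j : Fin p) → H0vanishes M G (CyclotomicHom.ζ φ) (p ^ (n ∸ 1)) p (p ^ (n ∸ 1) *ℕ toℕ j)) →
    (∀ (j : Fin (p ^ n)) → H0vanishes M G (CyclotomicHom.ζ φ) 1 (p ^ n) (toℕ j))
    × Σ (Fin (p ^ n) → ℕ) (λ c → Σ (Fin (p ^ n) → ℕ) (λ d →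
        (∀ (j : Fin (p ^ n)) → HasCard M (eigen M G (CyclotomicHom.ζ φ) 1 (p ^ n) (toℕ j)) (c j))
        × (∀ (j : Fin (p ^ n)) → HasCard M (epsImage M G (CyclotomicHom.ζ φ) 1 (p ^ n) (toℕ j)) (d j))
        × (proj₁ fin ≡ prodFin (p ^ n) c)
        × (proj₁ fin ≡ prodFin (p ^ n) d)))
theorem4p10 zero          n p-prime with () ← prime⇒nonZero p-prime
theorem4p10 (suc zero)    n p-prime with () ← prime⇒nonTrivial p-prime
theorem4p10 (suc (suc p'')) (suc k) p-prime _ R φ M G fin hyp =
  Ĥ⁰-vanishes , |M^ψ| , |M^ψ| , #eigen , #εImage , |M|≡∏|M^ψ| , |M|≡∏|M^ψ|
  where open TwistedCharacters p'' k p-prime φ G fin hyp
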